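{- No $\mathrm{RE}$-complete set is $\mathrm{F_{PR}}$-rankable.
   Context: $\Sigma=\{0,1\}$, with $\Sigma^\ast$ ordered by length then lexicographically. A set is $\mathrm{RE}$-complete if it is recursively enumerable and every recursively enumerable set many-one reduces to it via a total recursive function. $\mathrm{F_{PR}}$ is the class of partial recursive functions $\Sigma^\ast\to\Sigma^\ast$. A (possibly partial) function $f$ is a ranking function for $A$ if $f$ is defined on all of $A$ and for every $x\in A$, if $x$ is the $i$th element of $A$ then $f(x)$ is the $i$th string of $\Sigma^\ast$ (no condition outside $A$). $A$ is $\mathrm{F_{PR}}$-rankable if it has a ranking function in $\mathrm{F_{PR}}$. -}

module Defs where

open import Level using (0ℓ)
open import Data.Nat using (ℕ; zero; suc; _+_; _*_; _<_)
open import Data.Fin using (Fin)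
open import Data.Bool using (Bool; true; false)
open import Data.List using (List; []; _∷_; length)
open import Data.List.Membership.Propositional using (_∈_)
open import Data.List.Relation.Unary.Unique.Propositional using (Unique)
open import Data.Vec using (Vec; []; _∷_; lookup)
open import Data.Product using (Σ; ∃; _×_; _,_)
open import Data.Sum using (_⊎_)
open import Data.Unit using (⊤)
open import Relation.Binary.PropositionalEquality using (_≡_)
open import Relation.Nullary using (¬_)
open import Function.Bundles using (_⇔_)

-- Strings over Σ = {0,1}   (false = 0, true = 1)

Str : Set
Str = List Bool

-- lexicographic order on strings (used only for strings of equal length)
data _<lex_ : Str → Str → Set where
  here  : ∀ (x y : Str) → (false ∷ x) <lex (true ∷ y)
  there : ∀ {b x y} → x <lex y → (b ∷ x) <lex (b ∷ y)

_<ₗₗ_ : Str → Str → Set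
x <ₗₗ y = (length x < length y) ⊎ ((length x ≡ length y) × (x <lex y))

-- "x is the i-th element of B" (w.r.t. <ₗₗ): x ∈ B and exactly i elements
-- of B are strictly below x (the first element has i = 0).
IsIth : (Str → Set) → ℕ → Str → Set
IsIth B i x =
  B x × Σ (List Str) (λ L → Unique L × (∀ z → (z ∈ L) ⇔ (B z × z <ₗₗ x)) × length L ≡ i)

IsIthString : ℕ → Str → Set
IsIthString i y = IsIth (λ _ → ⊤) i y

data Code : ℕ → Set where
  zer  : ∀ {n} → Code n
  succ : Code 1
  proj : ∀ {n} → Fin n → Code n
  comp : ∀ {m n} → Code m → Vec (Code n) m → Code n
  prec : ∀ {n} → Code n → Code (suc (suc n)) → Code (suc n)
  mu   : ∀ {n} → Code (suc n) → Code n

-- big-step semantics: Eval c xs y  means  c(xs) is defined and equals y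
data Eval : ∀ {n} → Code n → Vec ℕ n → ℕ → Set
data EvalVec : ∀ {m n} → Vec (Code n) m → Vec ℕ n → Vec ℕ m → Set

data Eval where
  e-zer  : ∀ {n} {xs : Vec ℕ n} → Eval zer xs 0
  e-succ : ∀ {x} → Eval succ (x ∷ []) (suc x)
  e-proj : ∀ {n} {i : Fin n} {xs} → Eval (proj i) xs (lookup xs i)
  e-comp : ∀ {m n} {f : Code m} {gs : Vec (Code n) m} {xs ys y} →
           EvalVec gs xs ys → Eval f ys y → Eval (comp f gs) xs y
  e-prec0 : ∀ {n} {f : Code n} {g xs y} →
            Eval f xs y → Eval (prec f g) (0 ∷ xs) y
  e-precS : ∀ {n} {f : Code n} {g xs k r y} →
            Eval (prec f g) (k ∷ xs) r → Eval g (k ∷ r ∷ xs) y →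
            Eval (prec f g) (suc k ∷ xs) y
  e-mu : ∀ {n} {f : Code (suc n)} {xs y} →
         Eval f (y ∷ xs) 0 →
         (∀ z → z < y → ∃ λ k → Eval f (z ∷ xs) (suc k)) →
         Eval (mu f) xs y

data EvalVec where
  ev-[] : ∀ {n} {xs : Vec ℕ n} → EvalVec [] xs []
  ev-∷  : ∀ {m n} {g : Code n} {gs : Vec (Code n) m} {xs y ys} →
          Eval g xs y → EvalVec gs xs ys → EvalVec (g ∷ gs) xs (y ∷ ys)

-- Transfer to strings via a computable bijection Str ≅ ℕ
-- (bijective base-2 numeration, least significant digit first).

enc : Str → ℕ
enc []          = 0
enc (false ∷ s) = suc (2 * enc s)
enc (true ∷ s)  = 2 + 2 * enc s

-- A partial function Σ* ⇀ Σ* is given by its graph F (F x y : "F(x) = y").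
PartialFun : Set₁
PartialFun = Str → Str → Set

FPR : PartialFun → Set
FPR F = Σ (Code 1) λ c → ∀ x y → F x y ⇔ Eval c (enc x ∷ []) (enc y)

RE : (Str → Set) → Set
RE A = Σ (Code 1) λ c → ∀ x → A x ⇔ (∃ λ y → Eval c (enc x ∷ []) y)

_≤ₘ_ : (Str → Set) → (Str → Set) → Set
B ≤ₘ A = Σ (Code 1) λ c →
  ∀ x → Σ Str λ y → Eval c (enc x ∷ []) (enc y) × (B x ⇔ A y)

RE-complete : (Str → Set) → Set₁
RE-complete A = RE A × (∀ (B : Str → Set) → RE B → B ≤ₘ A)

IsRankingFunction : PartialFun → (Str → Set) → Set
IsRankingFunction F A =
  ∀ x i → IsIth A i x → Σ Str λ y → F x y × IsIthString i y

FPR-rankable : (Str → Set) → Set₁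
FPR-rankable A = Σ PartialFun λ F → FPR F × IsRankingFunction F A

-- Let r compute a ranking function of A and let g reduce the halting set K to A. Then the
-- complement of K becomes semi-decidable, contradicting the diagonal argument. If A has an
-- element above g(x), then x ∉ K is witnessed by some y ∈ A above g(x), with r(y) the i-th
-- string, together with a repetition-free list of i elements of A below y not containing
-- g(x): as y is the i-th element of A, the list exhausts its predecessors in A, so g(x) ∉ A.
-- If A is bounded it is finite, and x ∉ K is witnessed by g(x) lying outside this finite set.
-- Which case holds cannot be decided, but the goal ⊥ is stable under double negation, so the
-- case split and the enumerations of finite parts of A are all carried out under ¬¬.
--
-- The witnesses are checked primitive recursively: an evaluation of a μ-recursive code is
-- certified by a finite list of judgements that a primitive recursive checker accepts,
-- and the rank of a string is computed from its bijective base-2 code.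

module Submission where

open import Defs
open import Data.Bool using (Bool; true; false; if_then_else_; _∧_; _∨_; not; T)
open import Data.Bool.Properties using (∧-assoc; ∨-assoc; ∧-identityʳ; ∨-identityʳ)
open import Data.Empty using (⊥; ⊥-elim)
open import Data.Fin using (Fin; zero; suc; toℕ; #_)
open import Data.List using (List; []; _∷_; _++_; length; map; reverse; take; drop)
open import Data.List.Properties using (length-map; reverse-++; unfold-reverse; reverse-involutive; length-reverse; ++-identityʳ)
open import Data.List.Membership.Propositional using (_∈_; find; lose)
open import Data.List.Membership.Propositional.Properties using (∈-map⁺; ∈-map⁻; ∈-++⁺ˡ; ∈-++⁺ʳ)
open import Data.List.Relation.Binary.Pointwise using (Pointwise; []; _∷_)
import Data.List.Relation.Binary.Pointwise as Pointwise
open import Data.List.Relation.Binary.Subset.Propositional using (_⊆_)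
open import Data.List.Relation.Binary.Subset.Propositional.Properties using (xs⊆xs++ys)
open import Data.List.Relation.Unary.All using (All; []; _∷_)
import Data.List.Relation.Unary.All as All
import Data.List.Relation.Unary.All.Properties as Allₚ
open import Data.List.Relation.Unary.Any using (Any; here; there)
open import Data.List.Relation.Unary.Unique.Propositional using (Unique; []; _∷_)
import Data.List.Relation.Unary.Unique.Propositional.Properties as Unique
open import Data.Nat using (ℕ; zero; suc; _+_; _*_; _∸_; _^_; _<_; _≤_; z≤n; s≤s; pred; _≡ᵇ_; _<ᵇ_; _≟_; _<?_)
open import Data.Nat.Properties
open import Data.Product using (Σ; ∃; _×_; _,_; proj₁; proj₂)
open import Data.Sum using (_⊎_; inj₁; inj₂)
open import Data.Unit using (tt)
open import Data.Vec using (Vec; []; _∷_; lookup; head; tail; tabulate)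
import Data.Vec as Vec
import Data.Vec.Properties as Vecₚ
open import Function.Base using (_∘_)
open import Function.Bundles using (_⇔_; mk⇔; Equivalence)
open import Relation.Binary.Definitions using (tri<; tri≈; tri>)
open import Relation.Binary.PropositionalEquality
open import Relation.Nullary using (¬_; yes; no)
open import Relation.Nullary.Decidable using (¬¬-excluded-middle)

-- Primitive recursive functions

data PR : ℕ → Set where
  pZ : ∀ {n} → PR n
  pS : PR 1
  pP : ∀ {n} → Fin n → PR n
  pC : ∀ {m n} → PR m → Vec (PR n) m → PR n
  pR : ∀ {n} → PR n → PR (suc (suc n)) → PR (suc n)

toCode : ∀ {n} → PR n → Code n
toCodes : ∀ {m n} → Vec (PR n) m → Vec (Code n) m
toCode pZ = zer
toCode pS = succ
toCode (pP i) = proj i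
toCode (pC f gs) = comp (toCode f) (toCodes gs)
toCode (pR f g) = prec (toCode f) (toCode g)
toCodes [] = []
toCodes (g ∷ gs) = toCode g ∷ toCodes gs

⟦_⟧ : ∀ {n} → PR n → Vec ℕ n → ℕ
⟦_⟧s : ∀ {m n} → Vec (PR n) m → Vec ℕ n → Vec ℕ m
recPR : ∀ {n} → PR n → PR (suc (suc n)) → ℕ → Vec ℕ n → ℕ
⟦ pZ ⟧ xs = 0
⟦ pS ⟧ (x ∷ []) = suc x
⟦ pP i ⟧ xs = lookup xs i
⟦ pC f gs ⟧ xs = ⟦ f ⟧ (⟦ gs ⟧s xs)
⟦ pR f g ⟧ (k ∷ xs) = recPR f g k xs
⟦ [] ⟧s xs = []
⟦ g ∷ gs ⟧s xs = ⟦ g ⟧ xs ∷ ⟦ gs ⟧s xs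
recPR f g zero xs = ⟦ f ⟧ xs
recPR f g (suc k) xs = ⟦ g ⟧ (k ∷ recPR f g k xs ∷ xs)

toCode-eval : ∀ {n} (p : PR n) xs → Eval (toCode p) xs (⟦ p ⟧ xs)
toCodes-eval : ∀ {m n} (gs : Vec (PR n) m) xs → EvalVec (toCodes gs) xs (⟦ gs ⟧s xs)
toCode-rec-eval : ∀ {n} (f : PR n) g k xs → Eval (prec (toCode f) (toCode g)) (k ∷ xs) (recPR f g k xs)
toCode-eval pZ xs = e-zer
toCode-eval pS (x ∷ []) = e-succ
toCode-eval (pP i) xs = e-proj
toCode-eval (pC f gs) xs = e-comp (toCodes-eval gs xs) (toCode-eval f _)
toCode-eval (pR f g) (k ∷ xs) = toCode-rec-eval f g k xs
toCodes-eval [] xs = ev-[]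
toCodes-eval (g ∷ gs) xs = ev-∷ (toCode-eval g xs) (toCodes-eval gs xs)
toCode-rec-eval f g zero xs = e-prec0 (toCode-eval f xs)
toCode-rec-eval f g (suc k) xs = e-precS (toCode-rec-eval f g k xs) (toCode-eval g _)

record Prim (n : ℕ) (f : Vec ℕ n → ℕ) : Set where
  constructor prim
  field
    code : PR n
    ok : ∀ xs → ⟦ code ⟧ xs ≡ f xs
open Prim

Prim-ext : ∀ {n f g} → (∀ xs → f xs ≡ g xs) → Prim n f → Prim n g
Prim-ext e (prim c o) = prim c (λ xs → trans (o xs) (e xs))

zeroP : ∀ {n} → Prim n (λ _ → 0)
zeroP = prim pZ (λ _ → refl)

varP : ∀ {n} (i : Fin n) → Prim n (λ xs → lookup xs i)
varP i = prim (pP i) (λ _ → refl)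

succP : Prim 1 (λ xs → suc (head xs))
succP = prim pS (λ { (x ∷ []) → refl })

comp₁ : ∀ {n f g} → Prim 1 f → Prim n g → Prim n (λ xs → f (g xs ∷ []))
comp₁ {f = f} (prim cf of) (prim cg og) = prim (pC cf (cg ∷ [])) (λ xs → trans (of _) (cong (λ a → f (a ∷ [])) (og xs)))

comp₂ : ∀ {n f g h} → Prim 2 f → Prim n g → Prim n h → Prim n (λ xs → f (g xs ∷ h xs ∷ []))
comp₂ {f = f} (prim cf of) (prim cg og) (prim ch oh) =
  prim (pC cf (cg ∷ ch ∷ [])) (λ xs → trans (of _) (cong₂ (λ a b → f (a ∷ b ∷ [])) (og xs) (oh xs)))

comp₃ : ∀ {n f g h k} → Prim 3 f → Prim n g → Prim n h → Prim n k → Prim n (λ xs → f (g xs ∷ h xs ∷ k xs ∷ []))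
comp₃ {f = f} (prim cf of) (prim cg og) (prim ch oh) (prim ck ok') =
  prim (pC cf (cg ∷ ch ∷ ck ∷ [])) (λ xs → trans (of _)
    (cong₃ (og xs) (oh xs) (ok' xs)))
  where
  cong₃ : ∀ {a a' b b' c c'} → a ≡ a' → b ≡ b' → c ≡ c' → f (a ∷ b ∷ c ∷ []) ≡ f (a' ∷ b' ∷ c' ∷ [])
  cong₃ refl refl refl = refl

primRec : ∀ {n} → (Vec ℕ n → ℕ) → (Vec ℕ (suc (suc n)) → ℕ) → ℕ → Vec ℕ n → ℕ
primRec f g zero xs = f xs
primRec f g (suc k) xs = g (k ∷ primRec f g k xs ∷ xs)

primRecP : ∀ {n f g} → Prim n f → Prim (suc (suc n)) g → Prim (suc n) (λ xs → primRec f g (head xs) (tail xs))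
primRecP {f = f} {g} (prim cf of) (prim cg og) = prim (pR cf cg) λ { (k ∷ xs) → go k xs }
  where
  go : ∀ k xs → recPR cf cg k xs ≡ primRec f g k xs
  go zero xs = of xs
  go (suc k) xs = trans (og _) (cong (λ a → g (k ∷ a ∷ xs)) (go k xs))

bit : Bool → ℕ
bit true = 1
bit false = 0

PrimB : (n : ℕ) → (Vec ℕ n → Bool) → Set
PrimB n p = Prim n (λ xs → bit (p xs))

at0 : ∀ {n} → Vec ℕ (suc n) → ℕ
at0 xs = lookup xs zero
at1 : ∀ {n} → Vec ℕ (suc (suc n)) → ℕ
at1 xs = lookup xs (suc zero)
at2 : ∀ {n} → Vec ℕ (suc (suc (suc n))) → ℕ
at2 xs = lookup xs (suc (suc zero))

v0 : ∀ {n} → Prim (suc n) (λ xs → lookup xs zero)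
v0 = varP zero
v1 : ∀ {n} → Prim (suc (suc n)) (λ xs → lookup xs (suc zero))
v1 = varP (suc zero)
v2 : ∀ {n} → Prim (suc (suc (suc n))) (λ xs → lookup xs (suc (suc zero)))
v2 = varP (suc (suc zero))
v3 : ∀ {n} → Prim (suc (suc (suc (suc n)))) (λ xs → lookup xs (suc (suc (suc zero))))
v3 = varP (suc (suc (suc zero)))

constP : ∀ {n} (c : ℕ) → Prim n (λ _ → c)
constP zero = zeroP
constP (suc c) = comp₁ succP (constP c)

projs : ∀ {m n} → (Fin m → Fin n) → Vec (PR n) m
projs {zero} f = []
projs {suc m} f = pP (f zero) ∷ projs (λ i → f (suc i))

projs-ok : ∀ {m n} (f : Fin m → Fin n) xs → ⟦ projs f ⟧s xs ≡ tabulate (λ i → lookup xs (f i))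
projs-ok {zero} f xs = refl
projs-ok {suc m} f xs = cong (lookup xs (f zero) ∷_) (projs-ok (λ i → f (suc i)) xs)

weakenP : ∀ {n f} → Prim n f → Prim (suc n) (λ xs → f (tail xs))
weakenP {n} {f} (prim c o) = prim (pC c (projs suc)) (λ xs → trans (cong ⟦ c ⟧ (lem xs)) (o (tail xs)))
  where
  lem : ∀ (xs : Vec ℕ (suc n)) → ⟦ projs suc ⟧s xs ≡ tail xs
  lem (x ∷ xs) = trans (projs-ok suc (x ∷ xs)) (Vecₚ.tabulate∘lookup xs)

predP : Prim 1 (λ xs → pred (at0 xs))
predP = Prim-ext (λ { (zero ∷ []) → refl ; (suc k ∷ []) → refl }) (primRecP zeroP v0)

addP : Prim 2 (λ xs → at0 xs + at1 xs)
addP = Prim-ext (λ { (a ∷ b ∷ []) → go a b }) (primRecP v0 (comp₁ succP v1))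
  where
  go : ∀ a b → primRec (λ ys → lookup ys zero) (λ ys → suc (lookup ys (suc zero))) a (b ∷ []) ≡ a + b
  go zero b = refl
  go (suc a) b = cong suc (go a b)

subP : Prim 2 (λ xs → at0 xs ∸ at1 xs)
subP = Prim-ext (λ { (a ∷ b ∷ []) → go b a }) (comp₂ (primRecP v0 (comp₁ predP v1)) v1 v0)
  where
  go : ∀ b a → primRec (λ ys → lookup ys zero) (λ ys → pred (lookup ys (suc zero))) b (a ∷ []) ≡ a ∸ b
  go zero a = refl
  go (suc b) a = trans (cong pred (go b a)) (pred[m∸n]≡m∸[1+n] a b)

isZeroP : PrimB 1 (λ xs → at0 xs ≡ᵇ 0)
isZeroP = Prim-ext (λ { (zero ∷ []) → refl ; (suc k ∷ []) → refl }) (primRecP (constP 1) zeroP)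

condN : ℕ → ℕ → ℕ → ℕ
condN zero a b = b
condN (suc _) a b = a

condP : Prim 3 (λ xs → condN (at0 xs) (at1 xs) (at2 xs))
condP = Prim-ext (λ { (zero ∷ a ∷ b ∷ []) → refl ; (suc k ∷ a ∷ b ∷ []) → refl }) (primRecP v1 v2)

ifP : ∀ {n p f g} → PrimB n p → Prim n f → Prim n g → Prim n (λ xs → if p xs then f xs else g xs)
ifP {p = p} {f} {g} bp pf pg = Prim-ext (λ xs → lem (p xs)) (comp₃ condP bp pf pg)
  where
  lem : ∀ {a c} b → condN (bit b) a c ≡ (if b then a else c)
  lem true = refl
  lem false = refl

andP : ∀ {n p q} → PrimB n p → PrimB n q → PrimB n (λ xs → p xs ∧ q xs)
andP {p = p} {q} bp bq = Prim-ext (λ xs → lem (p xs) (q xs)) (ifP bp bq zeroP)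
  where
  lem : ∀ b c → (if b then bit c else 0) ≡ bit (b ∧ c)
  lem true c = refl
  lem false c = refl

orP : ∀ {n p q} → PrimB n p → PrimB n q → PrimB n (λ xs → p xs ∨ q xs)
orP {p = p} {q} bp bq = Prim-ext (λ xs → lem (p xs) (q xs)) (ifP bp (constP 1) bq)
  where
  lem : ∀ b c → (if b then 1 else bit c) ≡ bit (b ∨ c)
  lem true c = refl
  lem false c = refl

notP : ∀ {n p} → PrimB n p → PrimB n (λ xs → not (p xs))
notP {p = p} bp = Prim-ext (λ xs → lem (p xs)) (ifP bp zeroP (constP 1))
  where
  lem : ∀ b → (if b then 0 else 1) ≡ bit (not b)
  lem true = refl
  lem false = refl

eqP : PrimB 2 (λ xs → at0 xs ≡ᵇ at1 xs)
eqP = Prim-ext (λ { (a ∷ b ∷ []) → cong bit (go a b) }) (comp₁ isZeroP (comp₂ addP subP (comp₂ subP v1 v0)))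
  where
  go : ∀ a b → ((a ∸ b) + (b ∸ a) ≡ᵇ 0) ≡ (a ≡ᵇ b)
  go zero zero = refl
  go zero (suc b) = refl
  go (suc a) zero = refl
  go (suc a) (suc b) = go a b

ltP : PrimB 2 (λ xs → at0 xs <ᵇ at1 xs)
ltP = Prim-ext (λ { (a ∷ b ∷ []) → cong bit (go a b) }) (comp₁ isZeroP (comp₂ subP (comp₁ succP v0) v1))
  where
  go : ∀ a b → (suc a ∸ b ≡ᵇ 0) ≡ (a <ᵇ b)
  go a zero = refl
  go zero (suc b) = cong (_≡ᵇ 0) (0∸n≡0 b)
  go (suc a) (suc b) = go a b

_+P_ : ∀ {n f g} → Prim n f → Prim n g → Prim n (λ xs → f xs + g xs)
a +P b = comp₂ addP a b
_-P_ : ∀ {n f g} → Prim n f → Prim n g → Prim n (λ xs → f xs ∸ g xs)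
a -P b = comp₂ subP a b
_==P_ : ∀ {n f g} → Prim n f → Prim n g → PrimB n (λ xs → f xs ≡ᵇ g xs)
a ==P b = comp₂ eqP a b
_<P_ : ∀ {n f g} → Prim n f → Prim n g → PrimB n (λ xs → f xs <ᵇ g xs)
a <P b = comp₂ ltP a b

renP : ∀ {m n f} (ρ : Fin m → Fin n) → Prim m f → Prim n (λ xs → f (tabulate (λ i → lookup xs (ρ i))))
renP {f = f} ρ (prim c o) = prim (pC c (projs ρ)) (λ xs → trans (cong ⟦ c ⟧ (projs-ok ρ xs)) (o _))

skip1 : ∀ {n} → Fin (suc n) → Fin (suc (suc n))
skip1 zero = zero
skip1 (suc i) = suc (suc i)

drop1P : ∀ {n f} → Prim (suc n) f → Prim (suc (suc n)) (λ xs → f (at0 xs ∷ tail (tail xs)))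
drop1P {f = f} p = Prim-ext (λ { (k ∷ a ∷ xs) → cong (λ v → f (k ∷ v)) (Vecₚ.tabulate∘lookup xs) }) (renP skip1 p)

bex : (ℕ → Bool) → ℕ → Bool
bex Q zero = false
bex Q (suc k) = bex Q k ∨ Q k

ball : (ℕ → Bool) → ℕ → Bool
ball Q zero = true
ball Q (suc k) = ball Q k ∧ Q k

bexP : ∀ {n q} → PrimB (suc n) q → PrimB (suc n) (λ xs → bex (λ k → q (k ∷ tail xs)) (at0 xs))
bexP {q = q} bq = Prim-ext (λ { (N ∷ xs) → go N xs }) (primRecP zeroP (comp₃ condP v1 (constP 1) (drop1P bq)))
  where
  lem : ∀ b c → condN (bit b) 1 (bit c) ≡ bit (b ∨ c)
  lem true c = refl
  lem false c = refl
  go : ∀ N xs → primRec (λ _ → 0) (λ ys → condN (lookup ys (suc zero)) 1 (bit (q (lookup ys zero ∷ tail (tail ys))))) N xs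
       ≡ bit (bex (λ k → q (k ∷ xs)) N)
  go zero xs = refl
  go (suc N) xs rewrite go N xs = lem (bex (λ k → q (k ∷ xs)) N) (q (N ∷ xs))

ballP : ∀ {n q} → PrimB (suc n) q → PrimB (suc n) (λ xs → ball (λ k → q (k ∷ tail xs)) (at0 xs))
ballP {q = q} bq = Prim-ext (λ { (N ∷ xs) → go N xs }) (primRecP (constP 1) (comp₃ condP v1 (drop1P bq) zeroP))
  where
  lem : ∀ b c → condN (bit b) (bit c) 0 ≡ bit (b ∧ c)
  lem true c = refl
  lem false c = refl
  go : ∀ N xs → primRec (λ _ → 1) (λ ys → condN (lookup ys (suc zero)) (bit (q (lookup ys zero ∷ tail (tail ys)))) 0) N xs
       ≡ bit (ball (λ k → q (k ∷ xs)) N)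
  go zero xs = refl
  go (suc N) xs rewrite go N xs = lem (ball (λ k → q (k ∷ xs)) N) (q (N ∷ xs))

∨-true : ∀ {a b} → (a ∨ b) ≡ true → a ≡ true ⊎ b ≡ true
∨-true {true} e = inj₁ refl
∨-true {false} e = inj₂ e

∧-true : ∀ {a b} → (a ∧ b) ≡ true → a ≡ true × b ≡ true
∧-true {true} e = refl , e

∧-intro : ∀ {a b} → a ≡ true → b ≡ true → (a ∧ b) ≡ true
∧-intro refl e = e

true≢false : true ≢ false
true≢false ()

∨-introˡ : ∀ {a b} → a ≡ true → (a ∨ b) ≡ true
∨-introˡ refl = refl

∨-introʳ : ∀ {a b} → b ≡ true → (a ∨ b) ≡ true
∨-introʳ {true} e = refl
∨-introʳ {false} e = e

bex-sound : ∀ Q N → bex Q N ≡ true → ∃ λ k → k < N × Q k ≡ true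
bex-sound Q zero ()
bex-sound Q (suc N) e with ∨-true {bex Q N} e
... | inj₁ e' = let (k , k<N , q) = bex-sound Q N e' in k , m<n⇒m<1+n k<N , q
... | inj₂ q = N , ≤-refl , q

bex-complete : ∀ Q N k → k < N → Q k ≡ true → bex Q N ≡ true
bex-complete Q (suc N) k k<N q with k ≟ N
... | yes refl = ∨-introʳ {bex Q k} q
... | no k≢N = ∨-introˡ (bex-complete Q N k (≤∧≢⇒< (≤-pred k<N) k≢N) q)

ball-sound : ∀ Q N → ball Q N ≡ true → ∀ k → k < N → Q k ≡ true
ball-sound Q (suc N) e k k<N with ∧-true {ball Q N} e | k ≟ N
... | _ , q | yes refl = q
... | b , _ | no k≢N = ball-sound Q N b k (≤∧≢⇒< (≤-pred k<N) k≢N)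

ball-complete : ∀ Q N → (∀ k → k < N → Q k ≡ true) → ball Q N ≡ true
ball-complete Q zero h = refl
ball-complete Q (suc N) h = ∧-intro (ball-complete Q N (λ k k<N → h k (m<n⇒m<1+n k<N))) (h N ≤-refl)

-- Cantor pairing and lists of natural numbers

tri : ℕ → ℕ
tri zero = 0
tri (suc k) = tri k + suc k

diag : ℕ → ℕ
diag zero = 0
diag (suc n) = if tri (suc (diag n)) <ᵇ suc (suc n) then suc (diag n) else diag n

π₂ : ℕ → ℕ
π₂ n = n ∸ tri (diag n)

π₁ : ℕ → ℕ
π₁ n = diag n ∸ π₂ n

pair : ℕ → ℕ → ℕ
pair a b = tri (a + b) + b

triP : Prim 1 (λ xs → tri (at0 xs))
triP = Prim-ext (λ { (k ∷ []) → go k }) (primRecP zeroP (v1 +P comp₁ succP v0))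
  where
  go : ∀ k → primRec (λ _ → 0) (λ ys → lookup ys (suc zero) + suc (lookup ys zero)) k [] ≡ tri k
  go zero = refl
  go (suc k) = cong (_+ suc k) (go k)

diagP : Prim 1 (λ xs → diag (at0 xs))
diagP = Prim-ext (λ { (k ∷ []) → go k }) (primRecP zeroP (ifP (comp₁ triP (comp₁ succP v1) <P comp₁ succP (comp₁ succP v0)) (comp₁ succP v1) v1))
  where
  go : ∀ k → primRec (λ _ → 0) (λ ys → if tri (suc (lookup ys (suc zero))) <ᵇ suc (suc (lookup ys zero)) then suc (lookup ys (suc zero)) else lookup ys (suc zero)) k [] ≡ diag k
  go zero = refl
  go (suc k) rewrite go k = refl

π₂P : Prim 1 (λ xs → π₂ (at0 xs))
π₂P = v0 -P comp₁ triP diagP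

π₁P : Prim 1 (λ xs → π₁ (at0 xs))
π₁P = diagP -P π₂P

pairP : Prim 2 (λ xs → pair (at0 xs) (at1 xs))
pairP = comp₁ triP (v0 +P v1) +P v1

tri-mono : ∀ {a b} → a ≤ b → tri a ≤ tri b
tri-mono {zero} {b} _ = z≤n
tri-mono {suc a} {suc b} (s≤s a≤b) = +-mono-≤ (tri-mono a≤b) (s≤s a≤b)

<ᵇ-true : ∀ {a b} → (a <ᵇ b) ≡ true → a < b
<ᵇ-true {a} {b} e = <ᵇ⇒< a b (subst T (sym e) _)

<ᵇ-intro : ∀ {a b} → a < b → (a <ᵇ b) ≡ true
<ᵇ-intro {a} {b} lt with a <ᵇ b | <⇒<ᵇ lt
... | true | _ = refl

<ᵇ-false : ∀ {a b} → (a <ᵇ b) ≡ false → b ≤ a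
<ᵇ-false {a} {b} e with a <? b
... | yes a<b = ⊥-elim (subst T e (<⇒<ᵇ a<b))
... | no ¬a<b = ≮⇒≥ ¬a<b

diag-inv : ∀ n → tri (diag n) ≤ n × n < tri (suc (diag n))
diag-inv zero = z≤n , s≤s z≤n
diag-inv (suc n) with diag-inv n | tri (suc (diag n)) <ᵇ suc (suc n) in eq
... | (lo , hi) | true = ≤-pred (<ᵇ-true eq) , (begin-strict
        suc n ≤⟨ hi ⟩ tri (suc (diag n)) <⟨ m<m+n (tri (suc (diag n))) (s≤s z≤n) ⟩ tri (suc (suc (diag n))) ∎)
  where open ≤-Reasoning
... | (lo , hi) | false = m≤n⇒m≤1+n lo , <ᵇ-false eq

diag-unique : ∀ {s d n} → tri s ≤ n → n < tri (suc s) → tri d ≤ n → n < tri (suc d) → s ≡ d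
diag-unique {s} {d} {n} l1 h1 l2 h2 with <-cmp s d
... | tri≈ _ e _ = e
... | tri< s<d _ _ = ⊥-elim (<⇒≱ h1 (≤-trans (tri-mono s<d) l2))
... | tri> _ _ d<s = ⊥-elim (<⇒≱ h2 (≤-trans (tri-mono d<s) l1))

diag-pair : ∀ a b → diag (pair a b) ≡ a + b
diag-pair a b = sym (diag-unique {a + b} lo hi (proj₁ (diag-inv _)) (proj₂ (diag-inv _)))
  where
  lo : tri (a + b) ≤ pair a b
  lo = m≤m+n _ _
  hi : pair a b < tri (suc (a + b))
  hi = +-monoʳ-< (tri (a + b)) (s≤s (m≤n+m b a))

π₂-pair : ∀ a b → π₂ (pair a b) ≡ b
π₂-pair a b rewrite diag-pair a b = m+n∸m≡n (tri (a + b)) b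

π₁-pair : ∀ a b → π₁ (pair a b) ≡ a
π₁-pair a b rewrite π₂-pair a b | diag-pair a b = m+n∸n≡m a b

π₂-≤ : ∀ n → π₂ n ≤ n
π₂-≤ n = m∸n≤m n (tri (diag n))

pair-≥₂ : ∀ a b → b ≤ pair a b
pair-≥₂ a b = m≤n+m b _

pair-surj : ∀ m → pair (π₁ m) (π₂ m) ≡ m
pair-surj m = trans (cong (λ s → tri s + π₂ m) e) (m∸n+n≡m' (proj₁ (diag-inv m)))
  where
  d = diag m
  p2≤d : π₂ m ≤ d
  p2≤d = ≤-pred (subst (π₂ m <_) (m+n∸m≡n (tri d) (suc d)) (∸-monoˡ-< (proj₂ (diag-inv m)) (proj₁ (diag-inv m))))
  e : π₁ m + π₂ m ≡ d
  e = m∸n+n≡m p2≤d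
  m∸n+n≡m' : tri d ≤ m → tri d + π₂ m ≡ m
  m∸n+n≡m' le = m+[n∸m]≡n le

PrimVec : (n k : ℕ) → (Vec ℕ n → Vec ℕ k) → Set
PrimVec n k gs = Σ (Vec (PR n) k) (λ cs → ∀ xs → ⟦ cs ⟧s xs ≡ gs xs)

[]ᵥ : ∀ {n} → PrimVec n 0 (λ _ → [])
[]ᵥ = [] , λ _ → refl

_∷ᵥ_ : ∀ {n k g gs} → Prim n g → PrimVec n k gs → PrimVec n (suc k) (λ xs → g xs ∷ gs xs)
prim c o ∷ᵥ (cs , ocs) = (c ∷ cs) , λ xs → cong₂ _∷_ (o xs) (ocs xs)
infixr 5 _∷ᵥ_

drop2ᵥ : ∀ {n} → PrimVec (suc (suc n)) n (λ xs → tail (tail xs))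
drop2ᵥ = projs (λ i → suc (suc i)) , λ { (x ∷ y ∷ xs) → trans (projs-ok _ (x ∷ y ∷ xs)) (Vecₚ.tabulate∘lookup xs) }

idᵥ : ∀ {n} → PrimVec n n (λ xs → xs)
idᵥ = projs (λ i → i) , λ xs → trans (projs-ok _ xs) (Vecₚ.tabulate∘lookup xs)

compᵥ : ∀ {n k f gs} → Prim k f → PrimVec n k gs → Prim n (λ xs → f (gs xs))
compᵥ {f = f} (prim c o) (cs , ocs) = prim (pC c cs) (λ xs → trans (cong ⟦ c ⟧ (ocs xs)) (o _))

cons : ℕ → ℕ → ℕ
cons a l = suc (pair a l)

hd tl : ℕ → ℕ
hd n = π₁ (pred n)
tl n = π₂ (pred n)

tails : ℕ → ℕ → ℕ
tails zero n = n
tails (suc k) n = tl (tails k n)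

fromList : List ℕ → ℕ
fromList [] = 0
fromList (a ∷ L) = cons a (fromList L)

toListF : ℕ → ℕ → List ℕ
toListF zero n = []
toListF (suc f) zero = []
toListF (suc f) (suc m) = π₁ m ∷ toListF f (π₂ m)

toList : ℕ → List ℕ
toList n = toListF n n

hd-cons : ∀ a l → hd (cons a l) ≡ a
hd-cons = π₁-pair
tl-cons : ∀ a l → tl (cons a l) ≡ l
tl-cons = π₂-pair

tl-≤ : ∀ n → tl n ≤ pred n
tl-≤ n = π₂-≤ (pred n)

fromList-toListF : ∀ f n → n ≤ f → fromList (toListF f n) ≡ n
fromList-toListF zero zero _ = refl
fromList-toListF (suc f) zero _ = refl
fromList-toListF (suc f) (suc m) (s≤s m≤f) =
  cong suc (trans (cong (pair (π₁ m)) (fromList-toListF f (π₂ m) (≤-trans (π₂-≤ m) m≤f))) (pair-surj m))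

fromList-toList : ∀ n → fromList (toList n) ≡ n
fromList-toList n = fromList-toListF n n ≤-refl

tails-suc : ∀ k n → tails (suc k) n ≡ tails k (tl n)
tails-suc zero n = refl
tails-suc (suc k) n = cong tl (tails-suc k n)

tails-≤ : ∀ k n → tails k n ≤ n ∸ k
tails-≤ zero n = ≤-refl
tails-≤ (suc k) n = begin
  tails (suc k) n ≡⟨ tails-suc k n ⟩
  tails k (tl n) ≤⟨ tails-≤ k (tl n) ⟩
  tl n ∸ k ≤⟨ ∸-monoˡ-≤ k (tl-≤ n) ⟩
  pred n ∸ k ≡⟨ lem n ⟩
  n ∸ suc k ∎
  where
  open ≤-Reasoning
  lem : ∀ n → pred n ∸ k ≡ n ∸ suc k
  lem zero = 0∸n≡0 k
  lem (suc n) = refl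

tails-0 : ∀ k n → n ≤ k → tails k n ≡ 0
tails-0 k n le = n≤0⇒n≡0 (≤-trans (tails-≤ k n) (≤-reflexive (m≤n⇒m∸n≡0 le)))

consP : Prim 2 (λ xs → cons (at0 xs) (at1 xs))
consP = comp₁ succP pairP
hdP : Prim 1 (λ xs → hd (at0 xs))
hdP = comp₁ π₁P predP
tlP : Prim 1 (λ xs → tl (at0 xs))
tlP = comp₁ π₂P predP
tailsP : Prim 2 (λ xs → tails (at0 xs) (at1 xs))
tailsP = Prim-ext (λ { (k ∷ n ∷ []) → go k n }) (primRecP v0 (comp₁ tlP v1))
  where
  go : ∀ k n → primRec (λ ys → lookup ys zero) (λ ys → tl (lookup ys (suc zero))) k (n ∷ []) ≡ tails k n
  go zero n = refl
  go (suc k) n = cong tl (go k n)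

anyL : (ℕ → Bool) → ℕ → Bool
anyL Q n = bex (λ k → not (tails k n ≡ᵇ 0) ∧ Q (hd (tails k n))) n

allL : (ℕ → Bool) → ℕ → Bool
allL Q n = ball (λ k → (tails k n ≡ᵇ 0) ∨ Q (hd (tails k n))) n

anyLP : ∀ {n q} → PrimB (suc n) q → PrimB (suc n) (λ xs → anyL (λ a → q (a ∷ tail xs)) (at0 xs))
anyLP bq = compᵥ (bexP (andP (notP (comp₂ tailsP v0 v1 ==P zeroP)) (compᵥ bq (comp₁ hdP (comp₂ tailsP v0 v1) ∷ᵥ drop2ᵥ)))) (v0 ∷ᵥ idᵥ)

allLP : ∀ {n q} → PrimB (suc n) q → PrimB (suc n) (λ xs → allL (λ a → q (a ∷ tail xs)) (at0 xs))
allLP bq = compᵥ (ballP (orP (comp₂ tailsP v0 v1 ==P zeroP) (compᵥ bq (comp₁ hdP (comp₂ tailsP v0 v1) ∷ᵥ drop2ᵥ)))) (v0 ∷ᵥ idᵥ)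

bex-cong : ∀ {F F'} → (∀ k → F k ≡ F' k) → ∀ N → bex F N ≡ bex F' N
bex-cong e zero = refl
bex-cong e (suc N) = cong₂ _∨_ (bex-cong e N) (e N)

ball-cong : ∀ {F F'} → (∀ k → F k ≡ F' k) → ∀ N → ball F N ≡ ball F' N
ball-cong e zero = refl
ball-cong e (suc N) = cong₂ _∧_ (ball-cong e N) (e N)

bex-shift : ∀ F N → bex F (suc N) ≡ F 0 ∨ bex (λ k → F (suc k)) N
bex-shift F zero with F 0
... | true = refl
... | false = refl
bex-shift F (suc N) = trans (cong (_∨ F (suc N)) (bex-shift F N)) (∨-assoc (F 0) _ _)

ball-shift : ∀ F N → ball F (suc N) ≡ F 0 ∧ ball (λ k → F (suc k)) N
ball-shift F zero with F 0
... | true = refl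
... | false = refl
ball-shift F (suc N) = trans (cong (_∧ F (suc N)) (ball-shift F N)) (∧-assoc (F 0) _ _)

bex-ext : ∀ F M N → M ≤ N → (∀ k → M ≤ k → F k ≡ false) → bex F N ≡ bex F M
bex-ext F M zero z≤n h = refl
bex-ext F M (suc N) le h with m≤n⇒m<n∨m≡n le
... | inj₂ refl = refl
... | inj₁ lt = trans (cong₂ _∨_ refl (h N (≤-pred lt))) (trans (∨-identityʳ _) (bex-ext F M N (≤-pred lt) h))

ball-ext : ∀ F M N → M ≤ N → (∀ k → M ≤ k → F k ≡ true) → ball F N ≡ ball F M
ball-ext F M zero z≤n h = refl
ball-ext F M (suc N) le h with m≤n⇒m<n∨m≡n le
... | inj₂ refl = refl
... | inj₁ lt = trans (cong₂ _∧_ refl (h N (≤-pred lt))) (trans (∧-identityʳ _) (ball-ext F M N (≤-pred lt) h))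

anyL-cons : ∀ Q a l → anyL Q (cons a l) ≡ Q a ∨ anyL Q l
anyL-cons Q a l = trans (bex-shift _ (pair a l)) (cong₂ _∨_ (cong Q (hd-cons a l)) (trans (bex-cong step (pair a l))
  (bex-ext _ l (pair a l) (pair-≥₂ a l) (λ k le → cong (λ t → not (t ≡ᵇ 0) ∧ Q (hd t)) (tails-0 k l le)))))
  where
  step : ∀ k → (not (tails (suc k) (cons a l) ≡ᵇ 0) ∧ Q (hd (tails (suc k) (cons a l)))) ≡ (not (tails k l ≡ᵇ 0) ∧ Q (hd (tails k l)))
  step k = cong (λ t → not (t ≡ᵇ 0) ∧ Q (hd t)) (trans (tails-suc k (cons a l)) (cong (tails k) (tl-cons a l)))

allL-cons : ∀ Q a l → allL Q (cons a l) ≡ Q a ∧ allL Q l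
allL-cons Q a l = trans (ball-shift _ (pair a l)) (cong₂ _∧_ (cong Q (hd-cons a l)) (trans (ball-cong step (pair a l))
  (ball-ext _ l (pair a l) (pair-≥₂ a l) (λ k le → cong (λ t → (t ≡ᵇ 0) ∨ Q (hd t)) (tails-0 k l le)))))
  where
  step : ∀ k → ((tails (suc k) (cons a l) ≡ᵇ 0) ∨ Q (hd (tails (suc k) (cons a l)))) ≡ ((tails k l ≡ᵇ 0) ∨ Q (hd (tails k l)))
  step k = cong (λ t → (t ≡ᵇ 0) ∨ Q (hd t)) (trans (tails-suc k (cons a l)) (cong (tails k) (tl-cons a l)))

anyL-sound : ∀ Q L → anyL Q (fromList L) ≡ true → Any (λ a → Q a ≡ true) L
anyL-sound Q [] ()
anyL-sound Q (a ∷ L) e with ∨-true {Q a} (trans (sym (anyL-cons Q a (fromList L))) e)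
... | inj₁ q = here q
... | inj₂ r = there (anyL-sound Q L r)

anyL-complete : ∀ Q L → Any (λ a → Q a ≡ true) L → anyL Q (fromList L) ≡ true
anyL-complete Q (a ∷ L) (here q) = trans (anyL-cons Q a (fromList L)) (∨-introˡ q)
anyL-complete Q (a ∷ L) (there p) = trans (anyL-cons Q a (fromList L)) (∨-introʳ {Q a} (anyL-complete Q L p))

allL-sound : ∀ Q L → allL Q (fromList L) ≡ true → All (λ a → Q a ≡ true) L
allL-sound Q [] _ = []
allL-sound Q (a ∷ L) e = let (q , r) = ∧-true {Q a} (trans (sym (allL-cons Q a (fromList L))) e) in q ∷ allL-sound Q L r

allL-complete : ∀ Q L → All (λ a → Q a ≡ true) L → allL Q (fromList L) ≡ true
allL-complete Q [] [] = refl
allL-complete Q (a ∷ L) (q ∷ r) = trans (allL-cons Q a (fromList L)) (∧-intro q (allL-complete Q L r))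

drop3ᵥ : ∀ {n} → PrimVec (suc (suc (suc n))) n (λ xs → tail (tail (tail xs)))
drop3ᵥ = projs (λ i → suc (suc (suc i))) , λ { (x ∷ y ∷ z ∷ xs) → trans (projs-ok _ (x ∷ y ∷ z ∷ xs)) (Vecₚ.tabulate∘lookup xs) }

allL2 : (ℕ → ℕ → Bool) → ℕ → ℕ → Bool
allL2 Q g y = ball (λ k → ((tails k g ≡ᵇ 0) ∧ (tails k y ≡ᵇ 0)) ∨ (not (tails k g ≡ᵇ 0) ∧ (not (tails k y ≡ᵇ 0) ∧ Q (hd (tails k g)) (hd (tails k y))))) (g + y)

allL2P : ∀ {n q} → PrimB (suc (suc n)) q → PrimB (suc (suc n)) (λ xs → allL2 (λ a b → q (a ∷ b ∷ tail (tail xs))) (at0 xs) (at1 xs))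
allL2P bq = compᵥ (ballP (orP (andP (comp₂ tailsP v0 v1 ==P zeroP) (comp₂ tailsP v0 v2 ==P zeroP))
                            (andP (notP (comp₂ tailsP v0 v1 ==P zeroP)) (andP (notP (comp₂ tailsP v0 v2 ==P zeroP))
                               (compᵥ bq (comp₁ hdP (comp₂ tailsP v0 v1) ∷ᵥ comp₁ hdP (comp₂ tailsP v0 v2) ∷ᵥ drop3ᵥ))))))
               ((v0 +P v1) ∷ᵥ idᵥ)

private
  G2 : (ℕ → ℕ → Bool) → ℕ → ℕ → ℕ → Bool
  G2 Q g y k = ((tails k g ≡ᵇ 0) ∧ (tails k y ≡ᵇ 0)) ∨ (not (tails k g ≡ᵇ 0) ∧ (not (tails k y ≡ᵇ 0) ∧ Q (hd (tails k g)) (hd (tails k y))))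

allL2-cc : ∀ Q a g b y → allL2 Q (cons a g) (cons b y) ≡ Q a b ∧ allL2 Q g y
allL2-cc Q a g b y = trans (ball-shift (G2 Q (cons a g) (cons b y)) (pair a g + suc (pair b y)))
  (cong₂ _∧_ (cong₂ Q (hd-cons a g) (hd-cons b y)) (trans (ball-cong step (pair a g + suc (pair b y)))
     (ball-ext (G2 Q g y) (g + y) _ (+-mono-≤ (pair-≥₂ a g) (m≤n⇒m≤1+n (pair-≥₂ b y)))
        (λ k le → cong₂ (λ t u → ((t ≡ᵇ 0) ∧ (u ≡ᵇ 0)) ∨ (not (t ≡ᵇ 0) ∧ (not (u ≡ᵇ 0) ∧ Q (hd t) (hd u))))
                     (tails-0 k g (≤-trans (m≤m+n g y) le)) (tails-0 k y (≤-trans (m≤n+m y g) le))))))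
  where
  e1 : ∀ k → tails (suc k) (cons a g) ≡ tails k g
  e1 k = trans (tails-suc k (cons a g)) (cong (tails k) (tl-cons a g))
  e2 : ∀ k → tails (suc k) (cons b y) ≡ tails k y
  e2 k = trans (tails-suc k (cons b y)) (cong (tails k) (tl-cons b y))
  step : ∀ k → G2 Q (cons a g) (cons b y) (suc k) ≡ G2 Q g y k
  step k = cong₂ (λ t u → ((t ≡ᵇ 0) ∧ (u ≡ᵇ 0)) ∨ (not (t ≡ᵇ 0) ∧ (not (u ≡ᵇ 0) ∧ Q (hd t) (hd u)))) (e1 k) (e2 k)

allL2-nc : ∀ Q b y → allL2 Q 0 (cons b y) ≡ false
allL2-nc Q b y = ball-shift (G2 Q 0 (cons b y)) (pair b y)

allL2-cn : ∀ Q a g → allL2 Q (cons a g) 0 ≡ false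
allL2-cn Q a g = trans (cong (ball (G2 Q (cons a g) 0)) (+-identityʳ (cons a g))) (ball-shift (G2 Q (cons a g) 0) (pair a g))

allL2-sound : ∀ Q G Y → allL2 Q (fromList G) (fromList Y) ≡ true → Pointwise (λ a b → Q a b ≡ true) G Y
allL2-sound Q [] [] e = []
allL2-sound Q [] (b ∷ Y) e with trans (sym (allL2-nc Q b (fromList Y))) e
... | ()
allL2-sound Q (a ∷ G) [] e with trans (sym (allL2-cn Q a (fromList G))) e
... | ()
allL2-sound Q (a ∷ G) (b ∷ Y) e =
  let (q , r) = ∧-true {Q a b} (trans (sym (allL2-cc Q a (fromList G) b (fromList Y))) e) in q ∷ allL2-sound Q G Y r

allL2-complete : ∀ Q G Y → Pointwise (λ a b → Q a b ≡ true) G Y → allL2 Q (fromList G) (fromList Y) ≡ true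
allL2-complete Q [] [] [] = refl
allL2-complete Q (a ∷ G) (b ∷ Y) (q ∷ r) = trans (allL2-cc Q a (fromList G) b (fromList Y)) (∧-intro q (allL2-complete Q G Y r))

anyIn : ∀ {n l q} → Prim n l → PrimB (suc n) q → PrimB n (λ xs → anyL (λ e → q (e ∷ xs)) (l xs))
anyIn L body = compᵥ (anyLP body) (L ∷ᵥ idᵥ)

allIn : ∀ {n l q} → Prim n l → PrimB (suc n) q → PrimB n (λ xs → allL (λ e → q (e ∷ xs)) (l xs))
allIn L body = compᵥ (allLP body) (L ∷ᵥ idᵥ)

ballIn : ∀ {n l q} → Prim n l → PrimB (suc n) q → PrimB n (λ xs → ball (λ e → q (e ∷ xs)) (l xs))
ballIn L body = compᵥ (ballP body) (L ∷ᵥ idᵥ)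

allL2In : ∀ {n g y q} → Prim n g → Prim n y → PrimB (suc (suc n)) q → PrimB n (λ xs → allL2 (λ a b → q (a ∷ b ∷ xs)) (g xs) (y xs))
allL2In G Y body = compᵥ (allL2P body) (G ∷ᵥ Y ∷ᵥ idᵥ)

-- Certificates for μ-recursive evaluations

⌜_⌝ : ∀ {n} → Code n → ℕ
⌜_⌝s : ∀ {m n} → Vec (Code n) m → List ℕ
⌜ zer ⌝ = pair 0 0
⌜ succ ⌝ = pair 1 0
⌜ proj i ⌝ = pair 2 (toℕ i)
⌜ comp f gs ⌝ = pair 3 (pair ⌜ f ⌝ (fromList ⌜ gs ⌝s))
⌜ prec f g ⌝ = pair 4 (pair ⌜ f ⌝ ⌜ g ⌝)
⌜ mu f ⌝ = pair 5 ⌜ f ⌝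
⌜ [] ⌝s = []
⌜ g ∷ gs ⌝s = ⌜ g ⌝ ∷ ⌜ gs ⌝s

encV : ∀ {n} → Vec ℕ n → ℕ
encV xs = fromList (Vec.toList xs)

tagOf payOf : ∀ {n} → Code n → ℕ
tagOf zer = 0
tagOf succ = 1
tagOf (proj i) = 2
tagOf (comp f gs) = 3
tagOf (prec f g) = 4
tagOf (mu f) = 5
payOf zer = 0
payOf succ = 0
payOf (proj i) = toℕ i
payOf (comp f gs) = pair ⌜ f ⌝ (fromList ⌜ gs ⌝s)
payOf (prec f g) = pair ⌜ f ⌝ ⌜ g ⌝
payOf (mu f) = ⌜ f ⌝

⌜⌝-pair : ∀ {n} (c : Code n) → ⌜ c ⌝ ≡ pair (tagOf c) (payOf c)
⌜⌝-pair zer = refl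
⌜⌝-pair succ = refl
⌜⌝-pair (proj i) = refl
⌜⌝-pair (comp f gs) = refl
⌜⌝-pair (prec f g) = refl
⌜⌝-pair (mu f) = refl

judgement : ℕ → ℕ → ℕ → ℕ
judgement c x y = pair c (pair x y)

codeOf inputOf outputOf : ℕ → ℕ
codeOf j = π₁ j
inputOf j = π₁ (π₂ j)
outputOf j = π₂ (π₂ j)

member : ℕ → ℕ → Bool
member e T = anyL (λ u → u ≡ᵇ e) T

-- A judgement ⟨⌜ c ⌝ , ⟨xs⟩ , y⟩ asserts Eval c xs y. Given the tag t and payload a of ⌜ c ⌝,
-- checkStep t a ⟨xs⟩ y T checks that the judgement follows by the evaluation rule for c
-- from judgements listed in T; a valid certificate is a list each of whose entries is
-- justified by the entries after it.
checkZero checkSucc checkProj checkComp checkPrec checkMu : ℕ → ℕ → ℕ → ℕ → Bool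
checkZero a x y T = y ≡ᵇ 0
checkSucc a x y T = y ≡ᵇ suc (hd x)
checkProj a x y T = y ≡ᵇ hd (tails a x)
checkComp a x y T = anyL (λ e → (codeOf e ≡ᵇ π₁ a) ∧ ((outputOf e ≡ᵇ y) ∧ allL2 (λ g v → member (judgement g x v) T) (π₂ a) (inputOf e))) T
checkPrec a x y T = ((hd x ≡ᵇ 0) ∧ member (judgement (π₁ a) (tl x) y) T) ∨
  (not (hd x ≡ᵇ 0) ∧ anyL (λ e → (codeOf e ≡ᵇ pair 4 a) ∧ ((inputOf e ≡ᵇ cons (pred (hd x)) (tl x)) ∧
     member (judgement (π₂ a) (cons (pred (hd x)) (cons (outputOf e) (tl x))) y) T)) T)
checkMu a x y T = member (judgement a (cons y x) 0) T ∧
  ball (λ z → anyL (λ e → (codeOf e ≡ᵇ a) ∧ ((inputOf e ≡ᵇ cons z x) ∧ not (outputOf e ≡ᵇ 0))) T) y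

checkStep : ℕ → ℕ → ℕ → ℕ → ℕ → Bool
checkStep t a x y T =
  if t ≡ᵇ 0 then checkZero a x y T else
  if t ≡ᵇ 1 then checkSucc a x y T else
  if t ≡ᵇ 2 then checkProj a x y T else
  if t ≡ᵇ 3 then checkComp a x y T else
  if t ≡ᵇ 4 then checkPrec a x y T else
  if t ≡ᵇ 5 then checkMu a x y T else false

checkJudgement : ℕ → ℕ → Bool
checkJudgement j T = checkStep (π₁ (codeOf j)) (π₂ (codeOf j)) (inputOf j) (outputOf j) T

codeOfP : Prim 1 (λ xs → codeOf (at0 xs))
codeOfP = π₁P
inputOfP : Prim 1 (λ xs → inputOf (at0 xs))
inputOfP = comp₁ π₁P π₂P
outputOfP : Prim 1 (λ xs → outputOf (at0 xs))
outputOfP = comp₁ π₂P π₂P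
judgementP : Prim 3 (λ xs → judgement (at0 xs) (at1 xs) (at2 xs))
judgementP = comp₂ pairP v0 (comp₂ pairP v1 v2)

memberP : PrimB 2 (λ xs → member (at0 xs) (at1 xs))
memberP = anyIn v1 (v0 ==P v1)

at3 : ∀ {n} → Vec ℕ (suc (suc (suc (suc n)))) → ℕ
at3 xs = lookup xs (suc (suc (suc zero)))
at4 : ∀ {n} → Vec ℕ (suc (suc (suc (suc (suc n))))) → ℕ
at4 xs = lookup xs (suc (suc (suc (suc zero))))

ifB : ∀ {n p f g} → PrimB n p → PrimB n f → PrimB n g → PrimB n (λ xs → if p xs then f xs else g xs)
ifB {p = p} {f} {g} bp bf bg = Prim-ext (λ xs → lem (p xs)) (ifP bp bf bg)
  where
  lem : ∀ {u w} c → (if c then bit u else bit w) ≡ bit (if c then u else w)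
  lem true = refl
  lem false = refl

checkZeroP : PrimB 4 (λ xs → checkZero (at0 xs) (at1 xs) (at2 xs) (at3 xs))
checkZeroP = v2 ==P zeroP
checkSuccP : PrimB 4 (λ xs → checkSucc (at0 xs) (at1 xs) (at2 xs) (at3 xs))
checkSuccP = v2 ==P comp₁ succP (comp₁ hdP v1)
checkProjP : PrimB 4 (λ xs → checkProj (at0 xs) (at1 xs) (at2 xs) (at3 xs))
checkProjP = v2 ==P comp₁ hdP (comp₂ tailsP v0 v1)
checkCompP : PrimB 4 (λ xs → checkComp (at0 xs) (at1 xs) (at2 xs) (at3 xs))
checkCompP = anyIn v3 (andP (comp₁ codeOfP v0 ==P comp₁ π₁P v1) (andP (comp₁ outputOfP v0 ==P v3)
        (allL2In (comp₁ π₂P v1) (comp₁ inputOfP v0) (comp₂ memberP (comp₃ judgementP v0 (varP (# 4)) v1) (varP (# 6))))))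
checkPrecP : PrimB 4 (λ xs → checkPrec (at0 xs) (at1 xs) (at2 xs) (at3 xs))
checkPrecP = orP (andP (comp₁ hdP v1 ==P zeroP) (comp₂ memberP (comp₃ judgementP (comp₁ π₁P v0) (comp₁ tlP v1) v2) v3))
          (andP (notP (comp₁ hdP v1 ==P zeroP)) (anyIn v3 (andP (comp₁ codeOfP v0 ==P comp₂ pairP (constP 4) v1)
             (andP (comp₁ inputOfP v0 ==P comp₂ consP (comp₁ predP (comp₁ hdP v2)) (comp₁ tlP v2))
               (comp₂ memberP (comp₃ judgementP (comp₁ π₂P v1) (comp₂ consP (comp₁ predP (comp₁ hdP v2)) (comp₂ consP (comp₁ outputOfP v0) (comp₁ tlP v2))) v3) (varP (# 4)))))))
checkMuP : PrimB 4 (λ xs → checkMu (at0 xs) (at1 xs) (at2 xs) (at3 xs))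
checkMuP = andP (comp₂ memberP (comp₃ judgementP v0 (comp₂ consP v2 v1) zeroP) v3)
           (ballIn v2 (anyIn (varP (# 4)) (andP (comp₁ codeOfP v0 ==P v2) (andP (comp₁ inputOfP v0 ==P comp₂ consP v1 v3) (notP (comp₁ outputOfP v0 ==P zeroP))))))

checkStepP : PrimB 5 (λ xs → checkStep (at0 xs) (at1 xs) (at2 xs) (at3 xs) (at4 xs))
checkStepP = Prim-ext (λ { (t ∷ a ∷ x ∷ y ∷ T ∷ []) → refl }) (ifB (v0 ==P constP 0) (weakenP checkZeroP) (ifB (v0 ==P constP 1) (weakenP checkSuccP) (ifB (v0 ==P constP 2) (weakenP checkProjP)
       (ifB (v0 ==P constP 3) (weakenP checkCompP) (ifB (v0 ==P constP 4) (weakenP checkPrecP) (ifB (v0 ==P constP 5) (weakenP checkMuP) (constP 0)))))))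

checkJudgementP : PrimB 2 (λ xs → checkJudgement (at0 xs) (at1 xs))
checkJudgementP = compᵥ checkStepP (comp₁ π₁P (comp₁ codeOfP v0) ∷ᵥ comp₁ π₂P (comp₁ codeOfP v0) ∷ᵥ comp₁ inputOfP v0 ∷ᵥ comp₁ outputOfP v0 ∷ᵥ v1 ∷ᵥ []ᵥ)

allCells : (ℕ → ℕ → Bool) → ℕ → Bool
allCells Q n = ball (λ k → (tails k n ≡ᵇ 0) ∨ Q (hd (tails k n)) (tl (tails k n))) n

allCellsP : ∀ {n q} → PrimB (suc (suc n)) q → PrimB (suc n) (λ xs → allCells (λ a t → q (a ∷ t ∷ tail xs)) (at0 xs))
allCellsP bq = compᵥ (ballP (orP (comp₂ tailsP v0 v1 ==P zeroP) (compᵥ bq (comp₁ hdP (comp₂ tailsP v0 v1) ∷ᵥ comp₁ tlP (comp₂ tailsP v0 v1) ∷ᵥ drop2ᵥ)))) (v0 ∷ᵥ idᵥ)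

allCells-cons : ∀ Q a l → allCells Q (cons a l) ≡ Q a l ∧ allCells Q l
allCells-cons Q a l = trans (ball-shift F (pair a l)) (cong₂ _∧_ (cong₂ Q (hd-cons a l) (tl-cons a l)) (trans (ball-cong step (pair a l))
  (ball-ext G l (pair a l) (pair-≥₂ a l) (λ k le → cong (λ t → (t ≡ᵇ 0) ∨ Q (hd t) (tl t)) (tails-0 k l le)))))
  where
  F = λ k → (tails k (cons a l) ≡ᵇ 0) ∨ Q (hd (tails k (cons a l))) (tl (tails k (cons a l)))
  G = λ k → (tails k l ≡ᵇ 0) ∨ Q (hd (tails k l)) (tl (tails k l))
  step : ∀ k → F (suc k) ≡ G k
  step k = cong (λ t → (t ≡ᵇ 0) ∨ Q (hd t) (tl t)) (trans (tails-suc k (cons a l)) (cong (tails k) (tl-cons a l)))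

valid : ℕ → Bool
valid c = allCells checkJudgement c

validP : PrimB 1 (λ xs → valid (at0 xs))
validP = Prim-ext (λ { (c ∷ []) → refl }) (allCellsP checkJudgementP)

valid-cons : ∀ j l → valid (cons j l) ≡ checkJudgement j l ∧ valid l
valid-cons = allCells-cons checkJudgement

≡ᵇ-true : ∀ {a b} → (a ≡ᵇ b) ≡ true → a ≡ b
≡ᵇ-true {a} {b} e = ≡ᵇ⇒≡ a b (subst T (sym e) _)

≡ᵇ-refl : ∀ a → (a ≡ᵇ a) ≡ true
≡ᵇ-refl zero = refl
≡ᵇ-refl (suc a) = ≡ᵇ-refl a

≡ᵇ-intro : ∀ {a b} → a ≡ b → (a ≡ᵇ b) ≡ true
≡ᵇ-intro {a} refl = ≡ᵇ-refl a

not-true : ∀ {b} → not b ≡ true → b ≡ false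
not-true {false} _ = refl

member-sound : ∀ e L → member e (fromList L) ≡ true → e ∈ L
member-sound e L m = let (e' , mem , p) = find (anyL-sound (λ u → u ≡ᵇ e) L m) in subst (_∈ L) (≡ᵇ-true p) mem

member-complete : ∀ e L → e ∈ L → member e (fromList L) ≡ true
member-complete e L m = anyL-complete (λ u → u ≡ᵇ e) L (lose m (≡ᵇ-refl e))

TrueJudgement : ℕ → Set
TrueJudgement j = ∀ {n} (c : Code n) (xs : Vec ℕ n) → codeOf j ≡ ⌜ c ⌝ → inputOf j ≡ encV xs → Eval c xs (outputOf j)

checkJudgement-tag : ∀ j t a T → codeOf j ≡ pair t a → checkJudgement j T ≡ checkStep t a (inputOf j) (outputOf j) T
checkJudgement-tag j t a T e rewrite e | π₁-pair t a | π₂-pair t a = refl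

codeOf-judgement : ∀ c x y → codeOf (judgement c x y) ≡ c
codeOf-judgement c x y = π₁-pair c _
inputOf-judgement : ∀ c x y → inputOf (judgement c x y) ≡ x
inputOf-judgement c x y rewrite π₂-pair c (pair x y) = π₁-pair x y
outputOf-judgement : ∀ c x y → outputOf (judgement c x y) ≡ y
outputOf-judgement c x y rewrite π₂-pair c (pair x y) = π₂-pair x y

lookup-enc : ∀ {n} (xs : Vec ℕ n) (i : Fin n) → hd (tails (toℕ i) (encV xs)) ≡ lookup xs i
lookup-enc (x ∷ xs) zero = hd-cons x _
lookup-enc (x ∷ xs) (suc i) = trans (cong hd (trans (tails-suc (toℕ i) (encV (x ∷ xs))) (cong (tails (toℕ i)) (tl-cons x _)))) (lookup-enc xs i)

premise-eval : ∀ {L} → All TrueJudgement L → ∀ {n} (c : Code n) (xs : Vec ℕ n) y → member (judgement ⌜ c ⌝ (encV xs) y) (fromList L) ≡ true → Eval c xs y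
premise-eval {L} all c xs y m = subst (Eval c xs) (outputOf-judgement ⌜ c ⌝ (encV xs) y) (All.lookup all (member-sound (judgement ⌜ c ⌝ (encV xs) y) L m) c xs (codeOf-judgement ⌜ c ⌝ (encV xs) y) (inputOf-judgement ⌜ c ⌝ (encV xs) y))

premises-evalVec : ∀ {L n m} → All TrueJudgement L → (gs : Vec (Code n) m) (xs : Vec ℕ n) (Y : List ℕ) →
  Pointwise (λ g v → member (judgement g (encV xs) v) (fromList L) ≡ true) ⌜ gs ⌝s Y →
  Σ (Vec ℕ m) (λ ys → EvalVec gs xs ys × Vec.toList ys ≡ Y)
premises-evalVec all [] xs [] [] = [] , ev-[] , refl
premises-evalVec all (g ∷ gs) xs (v ∷ Y) (p ∷ ps) =
  let (ys , ev , eq) = premises-evalVec all gs xs Y ps in (v ∷ ys) , ev-∷ (premise-eval all g xs v p) ev , cong (v ∷_) eq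

anyL-member : ∀ Q L → anyL Q (fromList L) ≡ true → ∃ λ e → e ∈ L × Q e ≡ true
anyL-member Q L h = find (anyL-sound Q L h)

checkPrec-zero : ∀ a X y T → checkPrec a (cons 0 X) y T ≡ member (judgement (π₁ a) X y) T ∨ false
checkPrec-zero a X y T rewrite hd-cons 0 X | tl-cons 0 X = refl

checkPrec-suc : ∀ a k X y T → checkPrec a (cons (suc k) X) y T ≡ anyL (λ e → (codeOf e ≡ᵇ pair 4 a) ∧ ((inputOf e ≡ᵇ cons k X) ∧ member (judgement (π₂ a) (cons k (cons (outputOf e) X)) y) T)) T
checkPrec-suc a k X y T rewrite hd-cons (suc k) X | tl-cons (suc k) X = refl

checkComp-sound : ∀ {m n} (f : Code m) (gs : Vec (Code n) m) xs y L → All TrueJudgement L →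
  checkComp (pair ⌜ f ⌝ (fromList ⌜ gs ⌝s)) (encV xs) y (fromList L) ≡ true → Eval (comp f gs) xs y
checkComp-sound f gs xs y L all h =
  let (e , e∈L , pe) = anyL-member (λ e → (codeOf e ≡ᵇ π₁ a) ∧ ((outputOf e ≡ᵇ y) ∧ allL2 R (π₂ a) (inputOf e))) L h
      (p₁ , p₂₃) = ∧-true {codeOf e ≡ᵇ π₁ a} pe
      (p₂ , p₃) = ∧-true {outputOf e ≡ᵇ y} p₂₃
      args = allL2-sound R ⌜ gs ⌝s (toList (inputOf e))
        (subst₂ (λ u w → allL2 R u w ≡ true) (π₂-pair ⌜ f ⌝ G) (sym (fromList-toList (inputOf e))) p₃)
      (ys , ev , ys≡) = premises-evalVec all gs xs (toList (inputOf e)) args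
      input≡ : inputOf e ≡ encV ys
      input≡ = trans (sym (fromList-toList (inputOf e))) (cong fromList (sym ys≡))
  in e-comp ev (subst (Eval f ys) (≡ᵇ-true p₂) (All.lookup all e∈L f ys (trans (≡ᵇ-true p₁) (π₁-pair ⌜ f ⌝ G)) input≡))
  where
  G = fromList ⌜ gs ⌝s
  a = pair ⌜ f ⌝ G
  R : ℕ → ℕ → Bool
  R g v = member (judgement g (encV xs) v) (fromList L)

checkMu-sound : ∀ {n} (f : Code (suc n)) xs y L → All TrueJudgement L →
  checkMu ⌜ f ⌝ (encV xs) y (fromList L) ≡ true → Eval (mu f) xs y
checkMu-sound f xs y L all h =
  let (zero-in , nonzero-in) = ∧-true {member (judgement ⌜ f ⌝ (encV (y ∷ xs)) 0) (fromList L)} h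
  in e-mu (premise-eval all f (y ∷ xs) 0 zero-in) λ z z<y →
     let (e , e∈L , pe) = anyL-member (Q z) L (ball-sound (λ z → anyL (Q z) (fromList L)) y nonzero-in z z<y)
         (q₁ , q₂₃) = ∧-true {codeOf e ≡ᵇ ⌜ f ⌝} pe
         (q₂ , q₃) = ∧-true {inputOf e ≡ᵇ encV (z ∷ xs)} q₂₃
     in nonzero (outputOf e) (not-true q₃) (All.lookup all e∈L f (z ∷ xs) (≡ᵇ-true q₁) (≡ᵇ-true q₂))
  where
  Q : ℕ → ℕ → Bool
  Q z e = (codeOf e ≡ᵇ ⌜ f ⌝) ∧ ((inputOf e ≡ᵇ cons z (encV xs)) ∧ not (outputOf e ≡ᵇ 0))
  nonzero : ∀ {z} w → (w ≡ᵇ 0) ≡ false → Eval f (z ∷ xs) w → ∃ λ k → Eval f (z ∷ xs) (suc k)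
  nonzero (suc w) _ ev = w , ev

checkStep-sound : ∀ {n} (c : Code n) xs y L → checkStep (tagOf c) (payOf c) (encV xs) y (fromList L) ≡ true → All TrueJudgement L → Eval c xs y
checkStep-sound zer xs y L h all = subst (Eval zer xs) (sym (≡ᵇ-true h)) e-zer
checkStep-sound succ (v ∷ []) y L h all rewrite hd-cons v 0 = subst (Eval succ (v ∷ [])) (sym (≡ᵇ-true h)) e-succ
checkStep-sound (proj i) xs y L h all rewrite lookup-enc xs i = subst (Eval (proj i) xs) (sym (≡ᵇ-true h)) e-proj
checkStep-sound (comp f gs) xs y L h all = checkComp-sound f gs xs y L all h
checkStep-sound (prec f g) (zero ∷ xs) y L h all =
  e-prec0 (premise-eval all f xs y (subst (λ u → member (judgement u (encV xs) y) (fromList L) ≡ true) (π₁-pair ⌜ f ⌝ ⌜ g ⌝)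
     (subst (_≡ true) (trans (checkPrec-zero (pair ⌜ f ⌝ ⌜ g ⌝) (encV xs) y (fromList L)) (∨-identityʳ _)) h)))
checkStep-sound (prec f g) (suc k ∷ xs) y L h all =
  let T = fromList L
      a = pair ⌜ f ⌝ ⌜ g ⌝
      (e , e∈L , pe) = anyL-member (λ e → (codeOf e ≡ᵇ pair 4 a) ∧ ((inputOf e ≡ᵇ cons k (encV xs)) ∧ member (judgement (π₂ a) (cons k (cons (outputOf e) (encV xs))) y) T)) L
                          (subst (_≡ true) (checkPrec-suc a k (encV xs) y T) h)
      (p₁ , p₂₃) = ∧-true {codeOf e ≡ᵇ ⌜ prec f g ⌝} pe
      (p₂ , p₃) = ∧-true {inputOf e ≡ᵇ encV (k ∷ xs)} p₂₃
      rec-eval = All.lookup all e∈L (prec f g) (k ∷ xs) (≡ᵇ-true p₁) (≡ᵇ-true p₂)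
  in e-precS rec-eval (premise-eval all g (k ∷ outputOf e ∷ xs) y (subst (λ u → member (judgement u (encV (k ∷ outputOf e ∷ xs)) y) T ≡ true) (π₂-pair ⌜ f ⌝ ⌜ g ⌝) p₃))
checkStep-sound (mu f) xs y L h all = checkMu-sound f xs y L all h

checkJudgement-sound : ∀ j L → checkJudgement j (fromList L) ≡ true → All TrueJudgement L → TrueJudgement j
checkJudgement-sound j L h all c xs ec ex = checkStep-sound c xs (outputOf j) L h' all
  where
  h' : checkStep (tagOf c) (payOf c) (encV xs) (outputOf j) (fromList L) ≡ true
  h' = subst (λ x → checkStep (tagOf c) (payOf c) x (outputOf j) (fromList L) ≡ true) ex
         (trans (sym (checkJudgement-tag j (tagOf c) (payOf c) (fromList L) (trans ec (⌜⌝-pair c)))) h)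

valid-sound : ∀ L → valid (fromList L) ≡ true → All TrueJudgement L
valid-sound [] _ = []
valid-sound (j ∷ L) h =
  let (p , q) = ∧-true {checkJudgement j (fromList L)} (trans (sym (valid-cons j (fromList L))) h)
      all = valid-sound L q
  in checkJudgement-sound j L p all ∷ all

anyL-mono : ∀ Q Q' L L' → L ⊆ L' → (∀ e → Q e ≡ true → Q' e ≡ true) → anyL Q (fromList L) ≡ true → anyL Q' (fromList L') ≡ true
anyL-mono Q Q' L L' s qq h =
  let (e , m , q) = anyL-member Q L h in anyL-complete Q' L' (lose (s m) (qq e q))

member-mono : ∀ e L L' → L ⊆ L' → member e (fromList L) ≡ true → member e (fromList L') ≡ true
member-mono e L L' s = anyL-mono (λ u → u ≡ᵇ e) (λ u → u ≡ᵇ e) L L' s (λ _ q → q)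

allL2-mono : ∀ Q Q' g y → (∀ a b → Q a b ≡ true → Q' a b ≡ true) → allL2 Q g y ≡ true → allL2 Q' g y ≡ true
allL2-mono Q Q' g y qq h =
  let h' = subst₂ (λ u w → allL2 Q u w ≡ true) (sym (fromList-toList g)) (sym (fromList-toList y)) h
      pw = allL2-sound Q (toList g) (toList y) h'
  in subst₂ (λ u w → allL2 Q' u w ≡ true) (fromList-toList g) (fromList-toList y)
       (allL2-complete Q' (toList g) (toList y) (Pointwise.map (λ {a} {b} → qq a b) pw))

ball-mono : ∀ Q Q' N → (∀ k → Q k ≡ true → Q' k ≡ true) → ball Q N ≡ true → ball Q' N ≡ true
ball-mono Q Q' N qq h = ball-complete Q' N (λ k k<N → qq k (ball-sound Q N h k k<N))

∧-mono : ∀ {a b a' b'} → (a ≡ true → a' ≡ true) → (b ≡ true → b' ≡ true) → (a ∧ b) ≡ true → (a' ∧ b') ≡ true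
∧-mono {a} f g h = let (p , q) = ∧-true {a} h in ∧-intro (f p) (g q)

∨-mono : ∀ {a b a' b'} → (a ≡ true → a' ≡ true) → (b ≡ true → b' ≡ true) → (a ∨ b) ≡ true → (a' ∨ b') ≡ true
∨-mono {a} {b} {a'} {b'} f g h with ∨-true {a} h
... | inj₁ p = ∨-introˡ (f p)
... | inj₂ q = ∨-introʳ {a'} (g q)

checkStep-mono : ∀ t a x y L L' → L ⊆ L' → checkStep t a x y (fromList L) ≡ true → checkStep t a x y (fromList L') ≡ true
checkStep-mono 0 a x y L L' s h = h
checkStep-mono 1 a x y L L' s h = h
checkStep-mono 2 a x y L L' s h = h
checkStep-mono 3 a x y L L' s h =
  anyL-mono (Q (fromList L)) (Q (fromList L')) L L' s (λ e → ∧-mono {codeOf e ≡ᵇ π₁ a} (λ p → p) (∧-mono {outputOf e ≡ᵇ y} (λ p → p)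
    (allL2-mono (λ g v → member (judgement g x v) (fromList L)) (λ g v → member (judgement g x v) (fromList L')) (π₂ a) (inputOf e) (λ g v → member-mono (judgement g x v) L L' s)))) h
  where
  Q : ℕ → ℕ → Bool
  Q T e = (codeOf e ≡ᵇ π₁ a) ∧ ((outputOf e ≡ᵇ y) ∧ allL2 (λ g v → member (judgement g x v) T) (π₂ a) (inputOf e))
checkStep-mono 4 a x y L L' s h =
  ∨-mono {(hd x ≡ᵇ 0) ∧ member (judgement (π₁ a) (tl x) y) (fromList L)}
    (∧-mono {hd x ≡ᵇ 0} (λ p → p) (member-mono (judgement (π₁ a) (tl x) y) L L' s))
    (∧-mono {not (hd x ≡ᵇ 0)} (λ p → p) (anyL-mono (Q (fromList L)) (Q (fromList L')) L L' s (λ e → ∧-mono {codeOf e ≡ᵇ pair 4 a} (λ p → p)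
       (∧-mono {inputOf e ≡ᵇ cons (pred (hd x)) (tl x)} (λ p → p) (member-mono (judgement (π₂ a) (cons (pred (hd x)) (cons (outputOf e) (tl x))) y) L L' s))))) h
  where
  Q : ℕ → ℕ → Bool
  Q T e = (codeOf e ≡ᵇ pair 4 a) ∧ ((inputOf e ≡ᵇ cons (pred (hd x)) (tl x)) ∧ member (judgement (π₂ a) (cons (pred (hd x)) (cons (outputOf e) (tl x))) y) T)
checkStep-mono 5 a x y L L' s h =
  ∧-mono {member (judgement a (cons y x) 0) (fromList L)} (member-mono (judgement a (cons y x) 0) L L' s)
    (ball-mono (λ z → anyL (Q z) (fromList L)) (λ z → anyL (Q z) (fromList L')) y (λ z → anyL-mono (Q z) (Q z) L L' s (λ e p → p))) h
  where
  Q : ℕ → ℕ → Bool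
  Q z e = (codeOf e ≡ᵇ a) ∧ ((inputOf e ≡ᵇ cons z x) ∧ not (outputOf e ≡ᵇ 0))
checkStep-mono (suc (suc (suc (suc (suc (suc t)))))) a x y L L' s ()

checkJudgement-mono : ∀ j L L' → L ⊆ L' → checkJudgement j (fromList L) ≡ true → checkJudgement j (fromList L') ≡ true
checkJudgement-mono j = checkStep-mono (π₁ (codeOf j)) (π₂ (codeOf j)) (inputOf j) (outputOf j)

valid-++ : ∀ L M → valid (fromList L) ≡ true → valid (fromList M) ≡ true → valid (fromList (L ++ M)) ≡ true
valid-++ [] M _ hM = hM
valid-++ (j ∷ L) M hL hM =
  let (p , q) = ∧-true {checkJudgement j (fromList L)} (trans (sym (valid-cons j (fromList L))) hL)
  in trans (valid-cons j (fromList (L ++ M))) (∧-intro (checkJudgement-mono j L (L ++ M) (xs⊆xs++ys L M) p) (valid-++ L M q hM))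

checkJudgement-judgement : ∀ {n} (c : Code n) X Y T → checkJudgement (judgement ⌜ c ⌝ X Y) T ≡ checkStep (tagOf c) (payOf c) X Y T
checkJudgement-judgement c X Y T = trans (checkJudgement-tag (judgement ⌜ c ⌝ X Y) (tagOf c) (payOf c) T (trans (codeOf-judgement ⌜ c ⌝ X Y) (⌜⌝-pair c)))
  (cong₂ (λ u w → checkStep (tagOf c) (payOf c) u w T) (inputOf-judgement ⌜ c ⌝ X Y) (outputOf-judgement ⌜ c ⌝ X Y))

Certificate : ∀ {n} → Code n → Vec ℕ n → ℕ → Set
Certificate c xs y = Σ (List ℕ) λ L → valid (fromList L) ≡ true × judgement ⌜ c ⌝ (encV xs) y ∈ L

certificate-extend : ∀ {n} (c : Code n) xs y L → valid (fromList L) ≡ true → checkStep (tagOf c) (payOf c) (encV xs) y (fromList L) ≡ true → Certificate c xs y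
certificate-extend c xs y L v o = (judgement ⌜ c ⌝ (encV xs) y ∷ L) ,
  trans (valid-cons (judgement ⌜ c ⌝ (encV xs) y) (fromList L)) (∧-intro (trans (checkJudgement-judgement c (encV xs) y (fromList L)) o) v) , here refl

<-suc-cases : ∀ {P : ℕ → Set} N → (∀ z → z < N → P z) → P N → ∀ z → z < suc N → P z
<-suc-cases N below at z z<1+N with z ≟ N
... | yes refl = at
... | no z≢N = below z (≤∧≢⇒< (≤-pred z<1+N) z≢N)

certify-comp : ∀ {m n} (f : Code m) (gs : Vec (Code n) m) (xs : Vec ℕ n) (ys : Vec ℕ m) y L₁ L₂ → valid (fromList L₁) ≡ true →
  Pointwise (λ g v → judgement g (encV xs) v ∈ L₁) ⌜ gs ⌝s (Vec.toList ys) →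
  valid (fromList L₂) ≡ true → judgement ⌜ f ⌝ (encV ys) y ∈ L₂ → Certificate (comp f gs) xs y
certify-comp f gs xs ys y L₁ L₂ valid₁ args valid₂ f∈L₂ =
  certificate-extend (comp f gs) xs y L (valid-++ L₁ L₂ valid₁ valid₂)
    (anyL-complete Q L (lose (∈-++⁺ʳ L₁ f∈L₂) (∧-intro q₁ (∧-intro q₂ q₃))))
  where
  L = L₁ ++ L₂
  G = fromList ⌜ gs ⌝s
  a = pair ⌜ f ⌝ G
  e = judgement ⌜ f ⌝ (encV ys) y
  R : ℕ → ℕ → Bool
  R g v = member (judgement g (encV xs) v) (fromList L)
  Q : ℕ → Bool
  Q e = (codeOf e ≡ᵇ π₁ a) ∧ ((outputOf e ≡ᵇ y) ∧ allL2 R (π₂ a) (inputOf e))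
  q₁ : (codeOf e ≡ᵇ π₁ a) ≡ true
  q₁ = ≡ᵇ-intro (trans (codeOf-judgement ⌜ f ⌝ (encV ys) y) (sym (π₁-pair ⌜ f ⌝ G)))
  q₂ : (outputOf e ≡ᵇ y) ≡ true
  q₂ = ≡ᵇ-intro (outputOf-judgement ⌜ f ⌝ (encV ys) y)
  q₃ : allL2 R (π₂ a) (inputOf e) ≡ true
  q₃ = subst₂ (λ u w → allL2 R u w ≡ true) (sym (π₂-pair ⌜ f ⌝ G)) (sym (inputOf-judgement ⌜ f ⌝ (encV ys) y))
    (allL2-complete R ⌜ gs ⌝s (Vec.toList ys)
      (Pointwise.map (λ {g} {v} m → member-complete (judgement g (encV xs) v) L m) (Pointwise.map (∈-++⁺ˡ) args)))

certify-prec-zero : ∀ {n} (f : Code n) g xs y L → valid (fromList L) ≡ true → judgement ⌜ f ⌝ (encV xs) y ∈ L →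
  Certificate (prec f g) (zero ∷ xs) y
certify-prec-zero f g xs y L L-valid f∈L = certificate-extend (prec f g) (zero ∷ xs) y L L-valid
  (subst (_≡ true) (sym (trans (checkPrec-zero (pair ⌜ f ⌝ ⌜ g ⌝) (encV xs) y (fromList L)) (∨-identityʳ _)))
    (subst (λ u → member (judgement u (encV xs) y) (fromList L) ≡ true) (sym (π₁-pair ⌜ f ⌝ ⌜ g ⌝)) (member-complete _ L f∈L)))

certify-prec-suc : ∀ {n} (f : Code n) g k xs r y L₁ L₂ → valid (fromList L₁) ≡ true → judgement ⌜ prec f g ⌝ (encV (k ∷ xs)) r ∈ L₁ →
  valid (fromList L₂) ≡ true → judgement ⌜ g ⌝ (encV (k ∷ r ∷ xs)) y ∈ L₂ → Certificate (prec f g) (suc k ∷ xs) y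
certify-prec-suc f g k xs r y L₁ L₂ valid₁ rec∈L₁ valid₂ g∈L₂ =
  certificate-extend (prec f g) (suc k ∷ xs) y L (valid-++ L₁ L₂ valid₁ valid₂)
    (subst (_≡ true) (sym (checkPrec-suc a k (encV xs) y (fromList L)))
      (anyL-complete Q L (lose (∈-++⁺ˡ rec∈L₁) (∧-intro q₁ (∧-intro q₂ q₃)))))
  where
  L = L₁ ++ L₂
  a = pair ⌜ f ⌝ ⌜ g ⌝
  e = judgement ⌜ prec f g ⌝ (encV (k ∷ xs)) r
  Q : ℕ → Bool
  Q e = (codeOf e ≡ᵇ pair 4 a) ∧ ((inputOf e ≡ᵇ cons k (encV xs)) ∧ member (judgement (π₂ a) (cons k (cons (outputOf e) (encV xs))) y) (fromList L))
  q₁ : (codeOf e ≡ᵇ pair 4 a) ≡ true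
  q₁ = ≡ᵇ-intro (codeOf-judgement ⌜ prec f g ⌝ (encV (k ∷ xs)) r)
  q₂ : (inputOf e ≡ᵇ cons k (encV xs)) ≡ true
  q₂ = ≡ᵇ-intro (inputOf-judgement ⌜ prec f g ⌝ (encV (k ∷ xs)) r)
  q₃ : member (judgement (π₂ a) (cons k (cons (outputOf e) (encV xs))) y) (fromList L) ≡ true
  q₃ = subst₂ (λ u w → member (judgement u (cons k (cons w (encV xs))) y) (fromList L) ≡ true)
    (sym (π₂-pair ⌜ f ⌝ ⌜ g ⌝)) (sym (outputOf-judgement ⌜ prec f g ⌝ (encV (k ∷ xs)) r)) (member-complete _ L (∈-++⁺ʳ L₁ g∈L₂))

NonzeroBelow : ∀ {n} → Code (suc n) → Vec ℕ n → ℕ → List ℕ → Set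
NonzeroBelow f xs y L = ∀ z → z < y → ∃ λ k → judgement ⌜ f ⌝ (encV (z ∷ xs)) (suc k) ∈ L

certify-mu : ∀ {n} (f : Code (suc n)) xs y L₀ L₁ → valid (fromList L₀) ≡ true → judgement ⌜ f ⌝ (encV (y ∷ xs)) 0 ∈ L₀ →
  valid (fromList L₁) ≡ true → NonzeroBelow f xs y L₁ → Certificate (mu f) xs y
certify-mu f xs y L₀ L₁ valid₀ zero∈L₀ valid₁ below =
  certificate-extend (mu f) xs y L (valid-++ L₀ L₁ valid₀ valid₁)
    (∧-intro (member-complete _ L (∈-++⁺ˡ zero∈L₀)) (ball-complete (λ z → anyL (Q z) (fromList L)) y nonzero))
  where
  L = L₀ ++ L₁
  Q : ℕ → ℕ → Bool
  Q z e = (codeOf e ≡ᵇ ⌜ f ⌝) ∧ ((inputOf e ≡ᵇ cons z (encV xs)) ∧ not (outputOf e ≡ᵇ 0))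
  nonzero : ∀ z → z < y → anyL (Q z) (fromList L) ≡ true
  nonzero z z<y =
    let (k , k∈L₁) = below z z<y
    in anyL-complete (Q z) L (lose (∈-++⁺ʳ L₀ k∈L₁) (∧-intro (≡ᵇ-intro (codeOf-judgement ⌜ f ⌝ (encV (z ∷ xs)) (suc k)))
         (∧-intro (≡ᵇ-intro (inputOf-judgement ⌜ f ⌝ (encV (z ∷ xs)) (suc k)))
           (cong (λ u → not (u ≡ᵇ 0)) (outputOf-judgement ⌜ f ⌝ (encV (z ∷ xs)) (suc k))))))

certificate-complete : ∀ {n} {c : Code n} {xs y} → Eval c xs y → Certificate c xs y
certificates-complete : ∀ {m n} {gs : Vec (Code n) m} {xs ys} → EvalVec gs xs ys →
  Σ (List ℕ) λ L → valid (fromList L) ≡ true × Pointwise (λ g v → judgement g (encV xs) v ∈ L) ⌜ gs ⌝s (Vec.toList ys)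
certify-nonzero-below : ∀ {n} (f : Code (suc n)) xs N → (∀ z → z < N → ∃ λ k → Eval f (z ∷ xs) (suc k)) →
  Σ (List ℕ) λ L → valid (fromList L) ≡ true × NonzeroBelow f xs N L

certificate-complete {xs = xs} e-zer = certificate-extend zer xs 0 [] refl refl
certificate-complete {xs = x ∷ []} e-succ = certificate-extend succ (x ∷ []) (suc x) [] refl (≡ᵇ-intro (cong suc (sym (hd-cons x 0))))
certificate-complete {c = proj i} {xs = xs} e-proj = certificate-extend (proj i) xs (lookup xs i) [] refl (≡ᵇ-intro (sym (lookup-enc xs i)))
certificate-complete {c = comp f gs} {xs = xs} {y} (e-comp {ys = ys} args ev) =
  let (L₁ , valid₁ , args∈L₁) = certificates-complete args
      (L₂ , valid₂ , f∈L₂) = certificate-complete ev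
  in certify-comp f gs xs ys y L₁ L₂ valid₁ args∈L₁ valid₂ f∈L₂
certificate-complete {c = prec f g} {xs = zero ∷ xs} {y} (e-prec0 ev) =
  let (L , L-valid , f∈L) = certificate-complete ev
  in certify-prec-zero f g xs y L L-valid f∈L
certificate-complete {c = prec f g} {xs = suc k ∷ xs} {y} (e-precS {r = r} ev₁ ev₂) =
  let (L₁ , valid₁ , rec∈L₁) = certificate-complete ev₁
      (L₂ , valid₂ , g∈L₂) = certificate-complete ev₂
  in certify-prec-suc f g k xs r y L₁ L₂ valid₁ rec∈L₁ valid₂ g∈L₂
certificate-complete {c = mu f} {xs = xs} {y} (e-mu ev nonzero) =
  let (L₀ , valid₀ , zero∈L₀) = certificate-complete ev
      (L₁ , valid₁ , below) = certify-nonzero-below f xs y nonzero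
  in certify-mu f xs y L₀ L₁ valid₀ zero∈L₀ valid₁ below

certificates-complete ev-[] = [] , refl , []
certificates-complete {xs = xs} (ev-∷ ev evs) =
  let (L₁ , valid₁ , j∈L₁) = certificate-complete ev
      (L₂ , valid₂ , js) = certificates-complete evs
  in (L₁ ++ L₂) , valid-++ L₁ L₂ valid₁ valid₂ , (∈-++⁺ˡ j∈L₁ ∷ Pointwise.map (∈-++⁺ʳ L₁) js)

certify-nonzero-below f xs zero nonzero = [] , refl , λ z ()
certify-nonzero-below f xs (suc N) nonzero =
  let (L₁ , valid₁ , below) = certify-nonzero-below f xs N (λ z z<N → nonzero z (m<n⇒m<1+n z<N))
      (k , ev) = nonzero N ≤-refl
      (L₂ , valid₂ , N∈L₂) = certificate-complete ev
  in (L₁ ++ L₂) , valid-++ L₁ L₂ valid₁ valid₂ ,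
     <-suc-cases N (λ z z<N → let (k′ , j) = below z z<N in k′ , ∈-++⁺ˡ j) (k , ∈-++⁺ʳ L₁ N∈L₂)

-- Unbounded search and the halting set

eval-det : ∀ {n} {c : Code n} {xs y y'} → Eval c xs y → Eval c xs y' → y ≡ y'
evalVec-det : ∀ {m n} {gs : Vec (Code n) m} {xs ys ys'} → EvalVec gs xs ys → EvalVec gs xs ys' → ys ≡ ys'
eval-det e-zer e-zer = refl
eval-det e-succ e-succ = refl
eval-det e-proj e-proj = refl
eval-det (e-comp v f) (e-comp v' f') with evalVec-det v v'
... | refl = eval-det f f'
eval-det (e-prec0 a) (e-prec0 b) = eval-det a b
eval-det (e-precS a b) (e-precS a' b') with eval-det a a'
... | refl = eval-det b b'
eval-det {y = y} {y'} (e-mu a h) (e-mu a' h') with <-cmp y y'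
... | tri≈ _ e _ = e
... | tri< y<y' _ _ = ⊥-elim (0≢1+n (eval-det a (proj₂ (h' y y<y'))))
... | tri> _ _ y'<y = ⊥-elim (0≢1+n (eval-det a' (proj₂ (h y' y'<y))))
evalVec-det ev-[] ev-[] = refl
evalVec-det (ev-∷ a as) (ev-∷ b bs) = cong₂ _∷_ (eval-det a b) (evalVec-det as bs)

Halts : ∀ {n} → Code n → Vec ℕ n → Set
Halts c xs = ∃ λ y → Eval c xs y

search : ∀ {n p} → PrimB (suc n) p → Code n
search bp = mu (toCode (code (notP bp)))

search-sound : ∀ {n p} (bp : PrimB (suc n) p) xs → Halts (search bp) xs → ∃ λ t → p (t ∷ xs) ≡ true
search-sound {p = p} bp xs (y , e-mu ev0 _) =
  y , lem (p (y ∷ xs)) (trans (sym (ok (notP bp) (y ∷ xs))) (eval-det (toCode-eval (code (notP bp)) (y ∷ xs)) ev0))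
  where
  lem : ∀ b → bit (not b) ≡ 0 → b ≡ true
  lem true _ = refl
  lem false ()

least : ∀ (q : ℕ → Bool) N → (∀ z → z < N → q z ≡ false) ⊎ (∃ λ t → t < N × q t ≡ true × (∀ z → z < t → q z ≡ false))
least q zero = inj₁ (λ z ())
least q (suc N) with least q N
... | inj₂ (t , t<N , qt , mn) = inj₂ (t , m<n⇒m<1+n t<N , qt , mn)
... | inj₁ all with q N in eq
... | true = inj₂ (N , ≤-refl , eq , all)
... | false = inj₁ λ z z<1+N → case z z<1+N
  where
  case : ∀ z → z < suc N → q z ≡ false
  case z z<1+N with z ≟ N
  ... | yes refl = eq
  ... | no z≢N = all z (≤∧≢⇒< (≤-pred z<1+N) z≢N)

search-complete : ∀ {n p} (bp : PrimB (suc n) p) xs → (∃ λ t → p (t ∷ xs) ≡ true) → Halts (search bp) xs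
search-complete {p = p} bp xs (t , pt) with least (λ z → p (z ∷ xs)) (suc t)
... | inj₁ all = ⊥-elim (true≢false (trans (sym pt) (all t ≤-refl)))
... | inj₂ (t' , _ , pt' , mn) =
  t' , e-mu (subst (Eval _ (t' ∷ xs)) (trans (ok (notP bp) (t' ∷ xs)) (cong (λ b → bit (not b)) pt')) (toCode-eval (code (notP bp)) (t' ∷ xs)))
          (λ z z<t' → 0 , subst (Eval _ (z ∷ xs)) (trans (ok (notP bp) (z ∷ xs)) (cong (λ b → bit (not b)) (mn z z<t'))) (toCode-eval (code (notP bp)) (z ∷ xs)))

on-toList : ∀ (Q : ℕ → Bool) n → Q n ≡ true → Q (fromList (toList n)) ≡ true
on-toList Q n = subst (λ u → Q u ≡ true) (sym (fromList-toList n))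

toList-valid : ∀ Cn → valid Cn ≡ true → All TrueJudgement (toList Cn)
toList-valid Cn v = valid-sound (toList Cn) (on-toList valid Cn v)

anyL-member-code : ∀ Q Cn → anyL Q Cn ≡ true → ∃ λ e → e ∈ toList Cn × Q e ≡ true
anyL-member-code Q Cn h = anyL-member Q (toList Cn) (on-toList (anyL Q) Cn h)

certificate-eval : ∀ Cn → valid Cn ≡ true → ∀ {n} (c : Code n) xs y → member (judgement ⌜ c ⌝ (encV xs) y) Cn ≡ true → Eval c xs y
certificate-eval Cn v c xs y m = premise-eval (toList-valid Cn v) c xs y (on-toList (member (judgement ⌜ c ⌝ (encV xs) y)) Cn m)

records : ℕ → ℕ → ℕ → Bool
records C p m = anyL (λ e → (codeOf e ≡ᵇ p) ∧ (inputOf e ≡ᵇ cons m 0)) C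

recordsP : PrimB 3 (λ xs → records (at0 xs) (at1 xs) (at2 xs))
recordsP = anyIn v0 (andP (comp₁ codeOfP v0 ==P v2) (comp₁ inputOfP v0 ==P comp₂ consP v3 zeroP))

records-sound : ∀ C (c : Code 1) m → valid C ≡ true → records C ⌜ c ⌝ m ≡ true → Halts c (m ∷ [])
records-sound C c m C-valid h =
  let (e , e∈C , q) = anyL-member-code (λ e → (codeOf e ≡ᵇ ⌜ c ⌝) ∧ (inputOf e ≡ᵇ cons m 0)) C h
      (q₁ , q₂) = ∧-true {codeOf e ≡ᵇ ⌜ c ⌝} q
  in outputOf e , All.lookup (toList-valid C C-valid) e∈C c (m ∷ []) (≡ᵇ-true q₁) (≡ᵇ-true q₂)

records-complete : ∀ L (c : Code 1) m y → judgement ⌜ c ⌝ (cons m 0) y ∈ L → records (fromList L) ⌜ c ⌝ m ≡ true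
records-complete L c m y j∈L = anyL-complete (λ e → (codeOf e ≡ᵇ ⌜ c ⌝) ∧ (inputOf e ≡ᵇ cons m 0)) L
  (lose j∈L (∧-intro (≡ᵇ-intro (codeOf-judgement ⌜ c ⌝ (cons m 0) y)) (≡ᵇ-intro (inputOf-judgement ⌜ c ⌝ (cons m 0) y))))

certify-all : ∀ (c : Code 1) L → All (λ l → Halts c (l ∷ [])) L →
  Σ (List ℕ) λ C → valid (fromList C) ≡ true × All (λ l → ∃ λ v → judgement ⌜ c ⌝ (cons l 0) v ∈ C) L
certify-all c [] [] = [] , refl , []
certify-all c (l ∷ L) ((v , ev) ∷ hs) =
  let (C₁ , valid₁ , j∈C₁) = certificate-complete ev
      (C₂ , valid₂ , js) = certify-all c L hs
  in C₁ ++ C₂ , valid-++ C₁ C₂ valid₁ valid₂ , (v , ∈-++⁺ˡ j∈C₁) ∷ All.map (λ (w , j) → w , ∈-++⁺ʳ C₁ j) js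

certifiedHalting : ℕ → ℕ → Bool
certifiedHalting t m = valid t ∧ records t m m

certifiedHaltingP : PrimB 2 (λ xs → certifiedHalting (at0 xs) (at1 xs))
certifiedHaltingP = andP (comp₁ validP v0) (comp₃ recordsP v0 v1 v1)

haltingCode : Code 1
haltingCode = search certifiedHaltingP

halting-universal : ∀ (c : Code 1) → Halts haltingCode (⌜ c ⌝ ∷ []) ⇔ Halts c (⌜ c ⌝ ∷ [])
halting-universal c = mk⇔
  (λ h → let (t , ok) = search-sound certifiedHaltingP (⌜ c ⌝ ∷ []) h
             (t-valid , t-records) = ∧-true {valid t} ok
         in records-sound t c ⌜ c ⌝ t-valid t-records)
  (λ (y , ev) → let (C , C-valid , j∈C) = certificate-complete ev
                in search-complete certifiedHaltingP (⌜ c ⌝ ∷ []) (fromList C , ∧-intro C-valid (records-complete C c ⌜ c ⌝ y j∈C)))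

-- Strings and their length-lexicographic rank

next : Str → Str
next [] = false ∷ []
next (false ∷ s) = true ∷ s
next (true ∷ s) = false ∷ next s

dec : ℕ → Str
dec zero = []
dec (suc n) = next (dec n)

enc-next : ∀ s → enc (next s) ≡ suc (enc s)
enc-next [] = refl
enc-next (false ∷ s) = refl
enc-next (true ∷ s) rewrite enc-next s | *-suc 2 (enc s) = refl

enc-dec : ∀ n → enc (dec n) ≡ n
enc-dec zero = refl
enc-dec (suc n) = trans (enc-next (dec n)) (cong suc (enc-dec n))

enc-injective : ∀ {s t} → enc s ≡ enc t → s ≡ t
enc-injective {[]} {[]} e = refl
enc-injective {[]} {false ∷ t} ()
enc-injective {[]} {true ∷ t} ()
enc-injective {false ∷ s} {[]} ()
enc-injective {true ∷ s} {[]} ()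
enc-injective {false ∷ s} {false ∷ t} e = cong (false ∷_) (enc-injective (*-cancelˡ-≡ _ _ 2 (suc-injective e)))
enc-injective {true ∷ s} {true ∷ t} e = cong (true ∷_) (enc-injective (*-cancelˡ-≡ _ _ 2 (suc-injective (suc-injective e))))
enc-injective {false ∷ s} {true ∷ t} e = ⊥-elim (even≢odd (enc s) (enc t) (suc-injective e))
enc-injective {true ∷ s} {false ∷ t} e = ⊥-elim (even≢odd (enc t) (enc s) (sym (suc-injective e)))

dec-enc : ∀ s → dec (enc s) ≡ s
dec-enc s = enc-injective (enc-dec (enc s))

dec-injective : ∀ {a b} → dec a ≡ dec b → a ≡ b
dec-injective {a} {b} e = trans (sym (enc-dec a)) (trans (cong enc e) (enc-dec b))

bv : Bool → ℕ
bv false = 1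
bv true = 2

enc-cons : ∀ b s → enc (b ∷ s) ≡ bv b + 2 * enc s
enc-cons false s = refl
enc-cons true s = refl

enc-snoc : ∀ L b → enc (L ++ b ∷ []) ≡ enc L + bv b * 2 ^ length L
enc-snoc [] b = trans (enc-cons b []) (trans (+-identityʳ (bv b)) (sym (*-identityʳ (bv b))))
enc-snoc (c ∷ L) b = begin
  enc (c ∷ L ++ b ∷ []) ≡⟨ enc-cons c (L ++ b ∷ []) ⟩
  bv c + 2 * enc (L ++ b ∷ []) ≡⟨ cong (λ u → bv c + 2 * u) (enc-snoc L b) ⟩
  bv c + 2 * (enc L + bv b * 2 ^ length L) ≡⟨ cong (bv c +_) (*-distribˡ-+ 2 (enc L) _) ⟩
  bv c + (2 * enc L + 2 * (bv b * 2 ^ length L)) ≡⟨ sym (+-assoc (bv c) _ _) ⟩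
  (bv c + 2 * enc L) + 2 * (bv b * 2 ^ length L) ≡⟨ cong₂ _+_ (sym (enc-cons c L)) (x*[y*z]≡y*[x*z] 2 (bv b) _) ⟩
  enc (c ∷ L) + bv b * 2 ^ length (c ∷ L) ∎
  where
  open ≡-Reasoning
  x*[y*z]≡y*[x*z] : ∀ x y z → x * (y * z) ≡ y * (x * z)
  x*[y*z]≡y*[x*z] x y z = trans (sym (*-assoc x y z)) (trans (cong (_* z) (*-comm x y)) (*-assoc y x z))

-- enc reads the least significant digit first; reversing makes the numeric order agree with <ₗₗ.
rank : Str → ℕ
rank s = enc (reverse s)

rank-cons : ∀ b s → rank (b ∷ s) ≡ rank s + bv b * 2 ^ length s
rank-cons b s = trans (cong enc (unfold-reverse b s)) (trans (enc-snoc (reverse s) b) (cong (λ k → rank s + bv b * 2 ^ k) (length-reverse s)))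

bv≥1 : ∀ b → 1 ≤ bv b
bv≥1 false = s≤s z≤n
bv≥1 true = s≤s z≤n

bv≤2 : ∀ b → bv b ≤ 2
bv≤2 false = s≤s z≤n
bv≤2 true = ≤-refl

rank-lower : ∀ s → 2 ^ length s ≤ suc (rank s)
rank-lower [] = ≤-refl
rank-lower (b ∷ s) = begin
  2 ^ suc (length s) ≡⟨ cong (2 ^ length s +_) (+-identityʳ (2 ^ length s)) ⟩
  2 ^ length s + 2 ^ length s ≤⟨ +-mono-≤ (rank-lower s) (subst (_≤ bv b * 2 ^ length s) (*-identityˡ (2 ^ length s)) (*-monoˡ-≤ (2 ^ length s) (bv≥1 b))) ⟩
  suc (rank s) + bv b * 2 ^ length s ≡⟨ cong suc (sym (rank-cons b s)) ⟩
  suc (rank (b ∷ s)) ∎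
  where open ≤-Reasoning

rank-upper : ∀ s → suc (rank s) < 2 * 2 ^ length s
rank-upper [] = s≤s (s≤s z≤n)
rank-upper (b ∷ s) = begin-strict
  suc (rank (b ∷ s)) ≡⟨ cong suc (rank-cons b s) ⟩
  suc (rank s) + bv b * 2 ^ length s <⟨ +-monoˡ-< _ (rank-upper s) ⟩
  2 * 2 ^ length s + bv b * 2 ^ length s ≤⟨ +-monoʳ-≤ (2 * 2 ^ length s) (*-monoˡ-≤ (2 ^ length s) (bv≤2 b)) ⟩
  2 * 2 ^ length s + 2 * 2 ^ length s ≡⟨ sym (*-distribʳ-+ (2 ^ length s) 2 2) ⟩
  4 * 2 ^ length s ≡⟨ *-assoc 2 2 (2 ^ length s) ⟩
  2 * 2 ^ length (b ∷ s) ∎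
  where open ≤-Reasoning

rank-length : ∀ x y → length x < length y → rank x < rank y
rank-length x y lt = ≤-pred (begin-strict
  suc (rank x) <⟨ rank-upper x ⟩
  2 ^ suc (length x) ≤⟨ ^-monoʳ-≤ 2 lt ⟩
  2 ^ length y ≤⟨ rank-lower y ⟩
  suc (rank y) ∎)
  where open ≤-Reasoning

rank-lex : ∀ x y → x <lex y → length x ≡ length y → rank x < rank y
rank-lex .(false ∷ x) .(true ∷ y) (here x y) el =
  subst₂ _<_ (sym (trans (rank-cons false x) (cong (rank x +_) (*-identityˡ P)))) (sym (trans (rank-cons true y) (cong (λ k → rank y + 2 * 2 ^ k) (sym e))))
    (≤-pred (subst (suc (suc (rank x + P)) ≤_) (trans (+-suc (2 * P) (rank y)) (cong suc (+-comm (2 * P) (rank y))))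
      (+-mono-≤ (rank-upper x) (subst (λ k → 2 ^ k ≤ suc (rank y)) (sym e) (rank-lower y)))))
  where
  e : length x ≡ length y
  e = suc-injective el
  P = 2 ^ length x
rank-lex (b ∷ x) (b ∷ y) (there x<y) el =
  subst₂ _<_ (sym (rank-cons b x)) (sym (trans (rank-cons b y) (cong (λ k → rank y + bv b * 2 ^ k) (sym e))))
    (+-monoˡ-< (bv b * 2 ^ length x) (rank-lex x y x<y e))
  where
  e : length x ≡ length y
  e = suc-injective el

rank-mono : ∀ x y → x <ₗₗ y → rank x < rank y
rank-mono x y (inj₁ lt) = rank-length x y lt
rank-mono x y (inj₂ (el , lx)) = rank-lex x y lx el

<lex-trichotomy : ∀ x y → length x ≡ length y → x <lex y ⊎ x ≡ y ⊎ y <lex x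
<lex-trichotomy [] [] _ = inj₂ (inj₁ refl)
<lex-trichotomy (false ∷ x) (true ∷ y) _ = inj₁ (here x y)
<lex-trichotomy (true ∷ x) (false ∷ y) _ = inj₂ (inj₂ (here y x))
<lex-trichotomy (false ∷ x) (false ∷ y) e with <lex-trichotomy x y (suc-injective e)
... | inj₁ l = inj₁ (there l)
... | inj₂ (inj₁ refl) = inj₂ (inj₁ refl)
... | inj₂ (inj₂ l) = inj₂ (inj₂ (there l))
<lex-trichotomy (true ∷ x) (true ∷ y) e with <lex-trichotomy x y (suc-injective e)
... | inj₁ l = inj₁ (there l)
... | inj₂ (inj₁ refl) = inj₂ (inj₁ refl)
... | inj₂ (inj₂ l) = inj₂ (inj₂ (there l))

<ₗₗ-trichotomy : ∀ x y → x <ₗₗ y ⊎ x ≡ y ⊎ y <ₗₗ x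
<ₗₗ-trichotomy x y with <-cmp (length x) (length y)
... | tri< l _ _ = inj₁ (inj₁ l)
... | tri> _ _ g = inj₂ (inj₂ (inj₁ g))
... | tri≈ _ e _ with <lex-trichotomy x y e
... | inj₁ l = inj₁ (inj₂ (e , l))
... | inj₂ (inj₁ eq) = inj₂ (inj₁ eq)
... | inj₂ (inj₂ l) = inj₂ (inj₂ (inj₂ (sym e , l)))

rank-reflects : ∀ x y → rank x < rank y → x <ₗₗ y
rank-reflects x y lt with <ₗₗ-trichotomy x y
... | inj₁ l = l
... | inj₂ (inj₁ refl) = ⊥-elim (<-irrefl refl lt)
... | inj₂ (inj₂ l) = ⊥-elim (<-asym lt (rank-mono y x l))

unrank : ℕ → Str
unrank k = reverse (dec k)

rank-unrank : ∀ k → rank (unrank k) ≡ k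
rank-unrank k = trans (cong enc (reverse-involutive (dec k))) (enc-dec k)

unrank-rank : ∀ s → unrank (rank s) ≡ s
unrank-rank s = trans (cong reverse (dec-enc (reverse s))) (reverse-involutive s)

module _ {A : Set} where
  remove : ∀ {z : A} {M} → z ∈ M → List A
  remove {M = _ ∷ M} (here _) = M
  remove {M = x ∷ M} (there p) = x ∷ remove p

  remove-length : ∀ {z : A} {M} (p : z ∈ M) → suc (length (remove p)) ≡ length M
  remove-length (here _) = refl
  remove-length {M = x ∷ M} (there p) = cong suc (remove-length p)

  remove-∈ : ∀ {z y : A} {M} (p : z ∈ M) → y ∈ M → y ≢ z → y ∈ remove p
  remove-∈ (here refl) (here refl) ne = ⊥-elim (ne refl)
  remove-∈ (here refl) (there q) ne = q
  remove-∈ (there p) (here refl) ne = here refl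
  remove-∈ (there p) (there q) ne = there (remove-∈ p q ne)

  unique-length-≤ : ∀ {L M : List A} → Unique L → (∀ {z} → z ∈ L → z ∈ M) → length L ≤ length M
  unique-length-≤ {[]} _ _ = z≤n
  unique-length-≤ {x ∷ L} {M} (nx ∷ u) sub =
    let p = sub (here refl)
        sub' : ∀ {z} → z ∈ L → z ∈ remove p
        sub' {z} m = remove-∈ p (sub (there m)) (λ e → All.lookup nx m (sym e))
    in subst (suc (length L) ≤_) (remove-length p) (s≤s (unique-length-≤ u sub'))

  unique-length-< : ∀ {L M : List A} {z} → Unique L → (∀ {w} → w ∈ L → w ∈ M) → z ∈ M → ¬ (z ∈ L) → length L < length M
  unique-length-< {L} {M} {z} u sub zM zL =
    subst (suc (length L) ≤_) (remove-length zM) (s≤s (unique-length-≤ u (λ {w} m → remove-∈ zM (sub m) (λ e → zL (subst (_∈ L) e m)))))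

  unique-length-≡ : ∀ {L M : List A} → Unique L → Unique M → (∀ {z} → z ∈ L → z ∈ M) → (∀ {z} → z ∈ M → z ∈ L) → length L ≡ length M
  unique-length-≡ uL uM f g = ≤-antisym (unique-length-≤ uL f) (unique-length-≤ uM g)

countdown : ℕ → List ℕ
countdown zero = []
countdown (suc n) = n ∷ countdown n

firstStrings : ℕ → List Str
firstStrings n = map unrank (countdown n)

firstStrings-length : ∀ n → length (firstStrings n) ≡ n
firstStrings-length zero = refl
firstStrings-length (suc n) = cong suc (firstStrings-length n)

firstStrings-rank : ∀ n {z} → z ∈ firstStrings n → rank z < n
firstStrings-rank (suc n) (here refl) = ≤-reflexive (cong suc (rank-unrank n))
firstStrings-rank (suc n) (there m) = m<n⇒m<1+n (firstStrings-rank n m)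

firstStrings-complete : ∀ n z → rank z < n → z ∈ firstStrings n
firstStrings-complete (suc n) z lt with rank z ≟ n
... | yes e = here (trans (sym (unrank-rank z)) (cong unrank e))
... | no ne = there (firstStrings-complete n z (≤∧≢⇒< (≤-pred lt) ne))

firstStrings-unique : ∀ n → Unique (firstStrings n)
firstStrings-unique zero = []
firstStrings-unique (suc n) = notin (firstStrings n) (λ m → firstStrings-rank n m) ∷ firstStrings-unique n
  where
  notin : ∀ L → (∀ {z} → z ∈ L → rank z < n) → All (λ w → ¬ (unrank n ≡ w)) L
  notin [] _ = []
  notin (w ∷ L) h = (λ e → <-irrefl (trans (cong rank (sym e)) (rank-unrank n)) (h (here refl))) ∷ notin L (λ m → h (there m))

ithString-rank : ∀ i s → IsIthString i s → i ≡ rank s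
ithString-rank i s (_ , L , uL , iff , len) = trans (sym len) (trans sl (firstStrings-length (rank s)))
  where
  sl : length L ≡ length (firstStrings (rank s))
  sl = unique-length-≡ uL (firstStrings-unique (rank s))
         (λ {z} m → firstStrings-complete (rank s) z (rank-mono z s (proj₂ (Equivalence.to (iff z) m))))
         (λ {z} m → Equivalence.from (iff z) (tt , rank-reflects z s (firstStrings-rank (rank s) m)))

-- Ranks, lengths and distinctness computed on codes

par half : ℕ → ℕ
par zero = 0
par (suc k) = 1 ∸ par k
half zero = 0
half (suc k) = half k + par k

parP : Prim 1 (λ xs → par (at0 xs))
parP = Prim-ext (λ { (k ∷ []) → go k }) (primRecP zeroP (constP 1 -P v1))
  where
  go : ∀ k → primRec (λ _ → 0) (λ ys → 1 ∸ lookup ys (suc zero)) k [] ≡ par k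
  go zero = refl
  go (suc k) = cong (1 ∸_) (go k)

halfP : Prim 1 (λ xs → half (at0 xs))
halfP = Prim-ext (λ { (k ∷ []) → go k }) (primRecP zeroP (v1 +P comp₁ parP v0))
  where
  go : ∀ k → primRec (λ _ → 0) (λ ys → lookup ys (suc zero) + par (lookup ys zero)) k [] ≡ half k
  go zero = refl
  go (suc k) = cong (_+ par k) (go k)

par-half : ∀ e → (par (2 * e) ≡ 0 × half (2 * e) ≡ e) × (par (suc (2 * e)) ≡ 1 × half (suc (2 * e)) ≡ e)
par-half zero = (refl , refl) , (refl , refl)
par-half (suc e) = subst (λ m → (par m ≡ 0 × half m ≡ suc e) × (par (suc m) ≡ 1 × half (suc m) ≡ suc e)) (sym (*-suc 2 e)) (go (par-half e))
  where
  go : (par (2 * e) ≡ 0 × half (2 * e) ≡ e) × (par (suc (2 * e)) ≡ 1 × half (suc (2 * e)) ≡ e) →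
       (par (suc (suc (2 * e))) ≡ 0 × half (suc (suc (2 * e))) ≡ suc e) × (par (suc (suc (suc (2 * e)))) ≡ 1 × half (suc (suc (suc (2 * e)))) ≡ suc e)
  go ((p0 , h0) , (p1 , h1)) rewrite p0 | h0 | +-identityʳ e = (refl , +-comm e 1) , (refl , trans (+-identityʳ (e + 1)) (+-comm e 1))

codeTail codeBit : ℕ → ℕ
codeTail n = half (pred n)
codeBit n = par (pred n)

codeTail-cons : ∀ b s → codeTail (enc (b ∷ s)) ≡ enc s
codeTail-cons false s = proj₂ (proj₁ (par-half (enc s)))
codeTail-cons true s = proj₂ (proj₂ (par-half (enc s)))

codeBit-cons : ∀ b s → codeBit (enc (b ∷ s)) ≡ bit b
codeBit-cons false s = proj₁ (proj₁ (par-half (enc s)))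
codeBit-cons true s = proj₁ (proj₂ (par-half (enc s)))

dropDigits : ℕ → ℕ → ℕ
dropDigits zero n = n
dropDigits (suc k) n = codeTail (dropDigits k n)

reversedPrefix : ℕ → ℕ → ℕ
reversedPrefix zero n = 0
reversedPrefix (suc k) n = if dropDigits k n ≡ᵇ 0 then reversedPrefix k n else suc (codeBit (dropDigits k n) + (reversedPrefix k n + reversedPrefix k n))

rankCode : ℕ → ℕ
rankCode n = reversedPrefix n n

drop-suc : ∀ {A : Set} k (s : List A) → drop (suc k) s ≡ drop 1 (drop k s)
drop-suc zero s = refl
drop-suc (suc k) [] = refl
drop-suc (suc k) (x ∷ s) = drop-suc k s

take-suc : ∀ {A : Set} k (s : List A) → take (suc k) s ≡ take k s ++ take 1 (drop k s)
take-suc zero [] = refl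
take-suc zero (x ∷ s) = refl
take-suc (suc k) [] = refl
take-suc (suc k) (x ∷ s) = cong (x ∷_) (take-suc k s)

codeTail-drop : ∀ t → codeTail (enc t) ≡ enc (drop 1 t)
codeTail-drop [] = refl
codeTail-drop (b ∷ t) = codeTail-cons b t

dropDigits-enc : ∀ k s → dropDigits k (enc s) ≡ enc (drop k s)
dropDigits-enc zero s = refl
dropDigits-enc (suc k) s = trans (cong codeTail (dropDigits-enc k s)) (trans (codeTail-drop (drop k s)) (cong enc (sym (drop-suc k s))))

2*≡ : ∀ a → 2 * a ≡ a + a
2*≡ a = cong (a +_) (+-identityʳ a)

reversedPrefix-enc : ∀ k s → reversedPrefix k (enc s) ≡ enc (reverse (take k s))
reversedPrefix-enc zero s = refl
reversedPrefix-enc (suc k) s rewrite dropDigits-enc k s | reversedPrefix-enc k s | take-suc k s with drop k s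
... | [] rewrite ++-identityʳ (take k s) = refl
... | false ∷ t rewrite reverse-++ (take k s) (false ∷ []) | codeBit-cons false t = cong suc (sym (2*≡ (enc (reverse (take k s)))))
... | true ∷ t rewrite reverse-++ (take k s) (true ∷ []) | codeBit-cons true t = cong (λ u → suc (suc u)) (sym (2*≡ (enc (reverse (take k s)))))

length≤enc : ∀ s → length s ≤ enc s
length≤enc [] = z≤n
length≤enc (false ∷ s) = s≤s (≤-trans (length≤enc s) (m≤m+n (enc s) _))
length≤enc (true ∷ s) = ≤-trans (s≤s (≤-trans (length≤enc s) (m≤m+n (enc s) _))) (n≤1+n _)

take-all : ∀ {A : Set} k (s : List A) → length s ≤ k → take k s ≡ s
take-all zero [] _ = refl
take-all (suc k) [] _ = refl
take-all (suc k) (x ∷ s) (s≤s le) = cong (x ∷_) (take-all k s le)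

rankCode-enc : ∀ s → rankCode (enc s) ≡ rank s
rankCode-enc s = trans (reversedPrefix-enc (enc s) s) (cong (λ t → enc (reverse t)) (take-all (enc s) s (length≤enc s)))

rankCode-dec-< : ∀ a b → rankCode a < rankCode b → rank (dec a) < rank (dec b)
rankCode-dec-< a b = subst₂ _<_ (rankCode-dec a) (rankCode-dec b)
  where
  rankCode-dec : ∀ n → rankCode n ≡ rank (dec n)
  rankCode-dec n = trans (cong rankCode (sym (enc-dec n))) (rankCode-enc (dec n))

codeTailP : Prim 1 (λ xs → codeTail (at0 xs))
codeTailP = comp₁ halfP predP
codeBitP : Prim 1 (λ xs → codeBit (at0 xs))
codeBitP = comp₁ parP predP

dropDigitsP : Prim 2 (λ xs → dropDigits (at0 xs) (at1 xs))
dropDigitsP = Prim-ext (λ { (k ∷ n ∷ []) → go k n }) (primRecP v0 (comp₁ codeTailP v1))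
  where
  go : ∀ k n → primRec (λ ys → lookup ys zero) (λ ys → codeTail (lookup ys (suc zero))) k (n ∷ []) ≡ dropDigits k n
  go zero n = refl
  go (suc k) n = cong codeTail (go k n)

reversedPrefixP : Prim 2 (λ xs → reversedPrefix (at0 xs) (at1 xs))
reversedPrefixP = Prim-ext (λ { (k ∷ n ∷ []) → go k n })
  (primRecP zeroP (ifP (comp₂ dropDigitsP v0 v2 ==P zeroP) v1 (comp₁ succP (comp₁ codeBitP (comp₂ dropDigitsP v0 v2) +P (v1 +P v1)))))
  where
  go : ∀ k n → primRec (λ _ → 0) (λ ys → if dropDigits (lookup ys zero) (lookup ys (suc (suc zero))) ≡ᵇ 0
                     then lookup ys (suc zero)
                     else suc (codeBit (dropDigits (lookup ys zero) (lookup ys (suc (suc zero))))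
                               + (lookup ys (suc zero) + lookup ys (suc zero)))) k (n ∷ []) ≡ reversedPrefix k n
  go zero n = refl
  go (suc k) n rewrite go k n = refl

rankCodeP : Prim 1 (λ xs → rankCode (at0 xs))
rankCodeP = comp₂ reversedPrefixP v0 v0

bsum : (ℕ → Bool) → ℕ → ℕ
bsum Q zero = 0
bsum Q (suc k) = bsum Q k + bit (Q k)

bsumP : ∀ {n q} → PrimB (suc n) q → Prim (suc n) (λ xs → bsum (λ k → q (k ∷ tail xs)) (at0 xs))
bsumP {q = q} bq = Prim-ext (λ { (N ∷ xs) → go N xs }) (primRecP zeroP (v1 +P drop1P bq))
  where
  go : ∀ N xs → primRec (λ _ → 0) (λ ys → lookup ys (suc zero) + bit (q (lookup ys zero ∷ tail (tail ys)))) N xs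
       ≡ bsum (λ k → q (k ∷ xs)) N
  go zero xs = refl
  go (suc N) xs = cong (_+ bit (q (N ∷ xs))) (go N xs)

bsum-cong : ∀ {F F'} → (∀ k → F k ≡ F' k) → ∀ N → bsum F N ≡ bsum F' N
bsum-cong e zero = refl
bsum-cong e (suc N) = cong₂ (λ a b → a + bit b) (bsum-cong e N) (e N)

bsum-shift : ∀ F N → bsum F (suc N) ≡ bit (F 0) + bsum (λ k → F (suc k)) N
bsum-shift F zero = +-comm 0 (bit (F 0))
bsum-shift F (suc N) = trans (cong (_+ bit (F (suc N))) (bsum-shift F N)) (+-assoc (bit (F 0)) _ _)

bsum-ext : ∀ F M N → M ≤ N → (∀ k → M ≤ k → F k ≡ false) → bsum F N ≡ bsum F M
bsum-ext F M zero z≤n h = refl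
bsum-ext F M (suc N) le h with m≤n⇒m<n∨m≡n le
... | inj₂ refl = refl
... | inj₁ lt = trans (cong (λ b → bsum F N + bit b) (h N (≤-pred lt))) (trans (+-identityʳ _) (bsum-ext F M N (≤-pred lt) h))

lengthCode : ℕ → ℕ
lengthCode n = bsum (λ k → not (tails k n ≡ᵇ 0)) n

lengthCodeP : Prim 1 (λ xs → lengthCode (at0 xs))
lengthCodeP = compᵥ (bsumP (notP (comp₂ tailsP v0 v1 ==P zeroP))) (v0 ∷ᵥ idᵥ)

lengthCode-cons : ∀ a l → lengthCode (cons a l) ≡ suc (lengthCode l)
lengthCode-cons a l = trans (bsum-shift F (pair a l)) (cong suc (trans (bsum-cong step (pair a l))
  (bsum-ext G l (pair a l) (pair-≥₂ a l) (λ k le → cong (λ t → not (t ≡ᵇ 0)) (tails-0 k l le)))))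
  where
  F = λ k → not (tails k (cons a l) ≡ᵇ 0)
  G = λ k → not (tails k l ≡ᵇ 0)
  step : ∀ k → F (suc k) ≡ G k
  step k = cong (λ t → not (t ≡ᵇ 0)) (trans (tails-suc k (cons a l)) (cong (tails k) (tl-cons a l)))

lengthCode-fromList : ∀ L → lengthCode (fromList L) ≡ length L
lengthCode-fromList [] = refl
lengthCode-fromList (a ∷ L) = trans (lengthCode-cons a (fromList L)) (cong suc (lengthCode-fromList L))

distinct : ℕ → Bool
distinct n = allCells (λ h t → not (member h t)) n

distinctP : PrimB 1 (λ xs → distinct (at0 xs))
distinctP = Prim-ext (λ { (c ∷ []) → refl }) (allCellsP (notP memberP))

member-false : ∀ e L → ¬ (e ∈ L) → member e (fromList L) ≡ false
member-false e L ne with member e (fromList L) in eq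
... | true = ⊥-elim (ne (member-sound e L eq))
... | false = refl

distinct-sound : ∀ L → distinct (fromList L) ≡ true → Unique L
distinct-sound [] _ = []
distinct-sound (a ∷ L) h =
  let (p , q) = ∧-true {not (member a (fromList L))} (trans (sym (allCells-cons (λ h t → not (member h t)) a (fromList L))) h)
  in allne L (λ m → true≢false (trans (sym (member-complete a L m)) (not-true p))) ∷ distinct-sound L q
  where
  allne : ∀ M → (a ∈ M → ⊥) → All (λ w → ¬ (a ≡ w)) M
  allne [] _ = []
  allne (w ∷ M) h = (λ e → h (here e)) ∷ allne M (λ m → h (there m))

distinct-complete : ∀ L → Unique L → distinct (fromList L) ≡ true
distinct-complete [] [] = refl
distinct-complete (a ∷ L) (na ∷ u) =
  trans (allCells-cons (λ h t → not (member h t)) a (fromList L))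
    (∧-intro (cong not (member-false a L (λ m → notin na m))) (distinct-complete L u))
  where
  notin : ∀ {M} → All (λ w → ¬ (a ≡ w)) M → a ∈ M → ⊥
  notin (p ∷ _) (here e) = p e
  notin (_ ∷ ps) (there m) = notin ps m

-- The reduction argument

¬¬-filter : ∀ {X : Set} (P : X → Set) (L : List X) → Unique L →
  ¬ ¬ (Σ (List X) λ M → Unique M × (∀ {z} → z ∈ M → z ∈ L × P z) × (∀ {z} → z ∈ L → P z → z ∈ M))
¬¬-filter P [] _ k = k ([] , [] , (λ ()) , (λ ()))
¬¬-filter P (x ∷ L) (x∉L ∷ L-unique) k = ¬¬-filter P L L-unique λ (M , M-unique , sub , sup) → ¬¬-excluded-middle {A = P x} λ
  { (yes px) → k ((x ∷ M) , (fresh M (λ m → proj₁ (sub m)) ∷ M-unique) ,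
        (λ { (here refl) → here refl , px ; (there m) → let (a , b) = sub m in there a , b }) ,
        (λ { (here refl) _ → here refl ; (there m) pz → there (sup m pz) }))
  ; (no ¬px) → k (M , M-unique , (λ m → let (a , b) = sub m in there a , b) ,
        (λ { (here refl) pz → ⊥-elim (¬px pz) ; (there m) pz → sup m pz })) }
  where
  fresh : ∀ N → (∀ {z} → z ∈ N → z ∈ L) → All (λ w → ¬ (x ≡ w)) N
  fresh [] _ = []
  fresh (w ∷ N) h = (λ e → All.lookup x∉L (h (here refl)) e) ∷ fresh N (λ m → h (there m))

K : Str → Set
K x = Halts haltingCode (enc x ∷ [])

SemiDecides : Code 1 → (Str → Set) → Set
SemiDecides e P = (∀ x → Halts e (enc x ∷ []) → P x) × (∀ x → P x → ¬ ¬ Halts e (enc x ∷ []))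

co-K-not-semidecidable : ∀ e → ¬ SemiDecides e (λ x → ¬ K x)
co-K-not-semidecidable e (halts⇒ , ⇒halts) = ⇒halts x₀ x₀∉K (λ h → x₀∉K (K-from h))
  where
  x₀ = dec ⌜ e ⌝
  K-to : K x₀ → Halts e (enc x₀ ∷ [])
  K-to k = subst (λ u → Halts e (u ∷ [])) (sym (enc-dec ⌜ e ⌝))
    (Equivalence.to (halting-universal e) (subst (λ u → Halts haltingCode (u ∷ [])) (enc-dec ⌜ e ⌝) k))
  K-from : Halts e (enc x₀ ∷ []) → K x₀
  K-from h = subst (λ u → Halts haltingCode (u ∷ [])) (sym (enc-dec ⌜ e ⌝))
    (Equivalence.from (halting-universal e) (subst (λ u → Halts e (u ∷ [])) (enc-dec ⌜ e ⌝) h))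
  x₀∉K : ¬ K x₀
  x₀∉K k = halts⇒ x₀ (K-to k) k

search-semidecides : ∀ {p} (bp : PrimB 2 p) (P : Str → Set) →
  (∀ x t → p (t ∷ enc x ∷ []) ≡ true → P x) → (∀ x → P x → ¬ ¬ ∃ λ t → p (t ∷ enc x ∷ []) ≡ true) →
  SemiDecides (search bp) P
search-semidecides bp P sound complete =
  (λ x h → let (t , pt) = search-sound bp (enc x ∷ []) h in sound x t pt) ,
  (λ x px k → complete x px λ t → k (search-complete bp (enc x ∷ []) t))

pack₅ : ℕ → ℕ → ℕ → ℕ → ℕ → ℕ
pack₅ a b c d e = pair a (pair b (pair c (pair d e)))

unpack₅ : {B : Set} → (ℕ → ℕ → ℕ → ℕ → ℕ → B) → ℕ → B
unpack₅ P w = P (π₁ w) (π₁ (π₂ w)) (π₁ (π₂ (π₂ w))) (π₁ (π₂ (π₂ (π₂ w)))) (π₂ (π₂ (π₂ (π₂ w))))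

unpack₅-pack₅ : ∀ {B : Set} (P : ℕ → ℕ → ℕ → ℕ → ℕ → B) a b c d e → unpack₅ P (pack₅ a b c d e) ≡ P a b c d e
unpack₅-pack₅ P a b c d e = cong₅ (π₁-pair a w₂) (trans (cong π₁ q₁) (π₁-pair b w₃)) (trans (cong π₁ q₂) (π₁-pair c w₄))
  (trans (cong π₁ q₃) (π₁-pair d e)) (trans (cong π₂ q₃) (π₂-pair d e))
  where
  w₄ = pair d e
  w₃ = pair c w₄
  w₂ = pair b w₃
  q₁ : π₂ (pack₅ a b c d e) ≡ w₂
  q₁ = π₂-pair a w₂
  q₂ : π₂ (π₂ (pack₅ a b c d e)) ≡ w₃
  q₂ = trans (cong π₂ q₁) (π₂-pair b w₃)
  q₃ : π₂ (π₂ (π₂ (pack₅ a b c d e))) ≡ w₄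
  q₃ = trans (cong π₂ q₂) (π₂-pair c w₄)
  cong₅ : ∀ {a′ b′ c′ d′ e′} → a′ ≡ a → b′ ≡ b → c′ ≡ c → d′ ≡ d → e′ ≡ e → P a′ b′ c′ d′ e′ ≡ P a b c d e
  cong₅ refl refl refl refl refl = refl

unpack₅P : ∀ {p} → PrimB 6 p → PrimB 2 (λ xs → unpack₅ (λ a b c d e → p (a ∷ b ∷ c ∷ d ∷ e ∷ at1 xs ∷ [])) (at0 xs))
unpack₅P bp = compᵥ bp (comp₁ π₁P v0 ∷ᵥ comp₁ π₁P (comp₁ π₂P v0) ∷ᵥ comp₁ π₁P (comp₁ π₂P (comp₁ π₂P v0))
  ∷ᵥ comp₁ π₁P (comp₁ π₂P (comp₁ π₂P (comp₁ π₂P v0))) ∷ᵥ comp₁ π₂P (comp₁ π₂P (comp₁ π₂P (comp₁ π₂P v0))) ∷ᵥ v1 ∷ᵥ []ᵥ)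

filter-IsIth : ∀ {A : Str → Set} y → A y → (M : List Str) → Unique M →
  (∀ {z} → z ∈ M → z ∈ firstStrings (rank y) × A z) → (∀ {z} → z ∈ firstStrings (rank y) → A z → z ∈ M) →
  IsIth A (length M) y
filter-IsIth y y∈A M M-unique sub sup = y∈A , M , M-unique ,
  (λ z → mk⇔ (λ m → let (z-below , z∈A) = sub m in z∈A , rank-reflects z y (firstStrings-rank (rank y) z-below))
             (λ (z∈A , z<y) → sup (firstStrings-complete (rank y) z (rank-mono z y z<y)) z∈A)) , refl

module Reduction (A : Str → Set) (a : Code 1) (A-RE : ∀ x → A x ⇔ Halts a (enc x ∷ []))
                 (g : Code 1) (K≤A : ∀ x → Σ Str λ y → Eval g (enc x ∷ []) (enc y) × (K x ⇔ A y)) where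

  reduce : Str → Str
  reduce x = proj₁ (K≤A x)

  reduce-eval : ∀ x → Eval g (enc x ∷ []) (enc (reduce x))
  reduce-eval x = proj₁ (proj₂ (K≤A x))

  K⇒A : ∀ {x} → K x → A (reduce x)
  K⇒A {x} = Equivalence.to (proj₂ (proj₂ (K≤A x)))

  A⇒K : ∀ {x} → A (reduce x) → K x
  A⇒K {x} = Equivalence.from (proj₂ (proj₂ (K≤A x)))

  A-halts : ∀ {y} → A y → Halts a (enc y ∷ [])
  A-halts {y} = Equivalence.to (A-RE y)

  halts-A : ∀ l → Halts a (l ∷ []) → A (dec l)
  halts-A l (v , ev) = Equivalence.from (A-RE (dec l)) (v , subst (λ u → Eval a (u ∷ []) v) (sym (enc-dec l)) ev)

  outsideCheck : ℕ → ℕ → ℕ → Bool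
  outsideCheck L₀ t m = valid t ∧ anyL (λ e → (codeOf e ≡ᵇ ⌜ g ⌝) ∧ ((inputOf e ≡ᵇ cons m 0) ∧ not (member (outputOf e) L₀))) t

  outsideCheckP : ∀ L₀ → PrimB 2 (λ xs → outsideCheck L₀ (at0 xs) (at1 xs))
  outsideCheckP L₀ = andP (comp₁ validP v0) (anyIn v0 (andP (comp₁ codeOfP v0 ==P constP ⌜ g ⌝)
    (andP (comp₁ inputOfP v0 ==P comp₂ consP v2 zeroP) (notP (comp₂ memberP (comp₁ outputOfP v0) (constP L₀))))))

  finite-impossible : (M : List Str) → (∀ y → A y → y ∈ M) → (∀ {y} → y ∈ M → A y) → ⊥
  finite-impossible M A⊆M M⊆A =
    co-K-not-semidecidable (search (outsideCheckP L₀)) (search-semidecides (outsideCheckP L₀) (λ x → ¬ K x) sound complete)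
    where
    L₀ = fromList (map enc M)
    Q : ℕ → ℕ → Bool
    Q m e = (codeOf e ≡ᵇ ⌜ g ⌝) ∧ ((inputOf e ≡ᵇ cons m 0) ∧ not (member (outputOf e) L₀))
    sound : ∀ x t → outsideCheck L₀ t (enc x) ≡ true → ¬ K x
    sound x t h x∈K =
      let (t-valid , found) = ∧-true {valid t} h
          (e , e∈t , q) = anyL-member-code (Q (enc x)) t found
          (q₁ , q₂₃) = ∧-true {codeOf e ≡ᵇ ⌜ g ⌝} q
          (q₂ , q₃) = ∧-true {inputOf e ≡ᵇ cons (enc x) 0} q₂₃
          e-eval = All.lookup (toList-valid t t-valid) e∈t g (enc x ∷ []) (≡ᵇ-true q₁) (≡ᵇ-true q₂)
          gx∈M = member-complete (enc (reduce x)) (map enc M) (∈-map⁺ enc (A⊆M (reduce x) (K⇒A x∈K)))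
      in true≢false (trans (sym gx∈M) (trans (cong (λ u → member u L₀) (eval-det (reduce-eval x) e-eval)) (not-true q₃)))
    complete : ∀ x → ¬ K x → ¬ ¬ ∃ λ t → outsideCheck L₀ t (enc x) ≡ true
    complete x x∉K k =
      let (C , C-valid , j∈C) = certificate-complete (reduce-eval x)
          gx∉M = member-false (enc (reduce x)) (map enc M) λ m →
                   let (u , u∈M , e) = ∈-map⁻ enc m in x∉K (A⇒K (subst A (sym (enc-injective e)) (M⊆A u∈M)))
          q₁ = ≡ᵇ-intro (codeOf-judgement ⌜ g ⌝ (cons (enc x) 0) (enc (reduce x)))
          q₂ = ≡ᵇ-intro (inputOf-judgement ⌜ g ⌝ (cons (enc x) 0) (enc (reduce x)))
          q₃ = cong (λ u → not (member u L₀)) (outputOf-judgement ⌜ g ⌝ (cons (enc x) 0) (enc (reduce x)))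
      in k (fromList C , ∧-intro C-valid (anyL-complete (Q (enc x)) C (lose j∈C (∧-intro q₁ (∧-intro q₂ (trans q₃ (cong not gx∉M)))))))

  bounded-impossible : (z₀ : Str) → (∀ y → A y → ¬ (z₀ <ₗₗ y)) → ⊥
  bounded-impossible z₀ bound = ¬¬-filter A (firstStrings (suc (rank z₀))) (firstStrings-unique _) λ (M , _ , sub , sup) →
    finite-impossible M
      (λ y y∈A → sup (firstStrings-complete (suc (rank z₀)) y (s≤s (≮⇒≥ λ lt → bound y y∈A (rank-reflects z₀ y lt)))) y∈A)
      (λ m → proj₂ (sub m))

  module Ranked (r : Code 1) (r-ranks : ∀ y i → IsIth A i y → ∃ λ s → Eval r (enc y ∷ []) (enc s) × rank s ≡ i) where

    record Witness (m : ℕ) : Set where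
      field
        z y s : ℕ
        L : List ℕ
        g-eval : Eval g (m ∷ []) z
        y-halts : Halts a (y ∷ [])
        r-eval : Eval r (y ∷ []) s
        L-halts : All (λ l → Halts a (l ∷ [])) L
        L-below : All (λ l → rankCode l < rankCode y) L
        L-unique : Unique L
        L-length : length L ≡ rankCode s
        z-below : rankCode z < rankCode y
        z∉L : ¬ z ∈ L

    -- Under ¬¬ let M list the elements of A below y; then |L| = |M| forces the repetition-free
    -- L ⊆ M to contain all of M, in particular g(x) if x ∈ K.
    Witness-sound : ∀ x → Witness (enc x) → ¬ K x
    Witness-sound x w x∈K =
      ¬¬-filter A (firstStrings (rank yˢ)) (firstStrings-unique _) λ (M , M-unique , sub , sup) →
        let (s′ , r-eval′ , rank-s′) = r-ranks yˢ (length M) (filter-IsIth yˢ y∈A M M-unique sub sup)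
            s≡ : s ≡ enc s′
            s≡ = eval-det (subst (λ u → Eval r (u ∷ []) s) (sym (enc-dec y)) r-eval) r-eval′
            L≡M : length (map dec L) ≡ length M
            L≡M = trans (length-map dec L) (trans L-length (trans (cong rankCode s≡) (trans (rankCode-enc s′) rank-s′)))
            L⊆M : ∀ {u} → u ∈ map dec L → u ∈ M
            L⊆M u∈ = let (l , l∈L , e) = ∈-map⁻ dec u∈ in subst (_∈ M) (sym e)
              (sup (firstStrings-complete (rank yˢ) (dec l) (rankCode-dec-< l y (All.lookup L-below l∈L)))
                   (halts-A l (All.lookup L-halts l∈L)))
            gx∈M = sup (firstStrings-complete (rank yˢ) (reduce x) gx<y) (K⇒A x∈K)
        in <-irrefl L≡M (unique-length-< (Unique.map⁺ dec-injective L-unique) L⊆M gx∈M gx∉L)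
      where
      open Witness w
      yˢ = dec y
      y∈A : A yˢ
      y∈A = halts-A y y-halts
      z≡ : z ≡ enc (reduce x)
      z≡ = eval-det g-eval (reduce-eval x)
      gx<y : rank (reduce x) < rank yˢ
      gx<y = subst (λ u → rank u < rank yˢ) (trans (cong dec z≡) (dec-enc (reduce x))) (rankCode-dec-< z y z-below)
      gx∉L : ¬ (reduce x ∈ map dec L)
      gx∉L gx∈ = let (l , l∈L , e) = ∈-map⁻ dec gx∈ in z∉L (subst (_∈ L) (trans (sym (enc-dec l)) (trans (cong enc (sym e)) (sym z≡))) l∈L)

    Witness-complete : ∀ x → ¬ K x → ∀ y → A y → reduce x <ₗₗ y → ¬ ¬ Witness (enc x)
    Witness-complete x x∉K y y∈A gx<y k =
      ¬¬-filter A (firstStrings (rank y)) (firstStrings-unique _) λ (M , M-unique , sub , sup) →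
        let (s , r-eval , rank-s) = r-ranks y (length M) (filter-IsIth y y∈A M M-unique sub sup)
        in k (record
          { z = enc (reduce x) ; y = enc y ; s = enc s ; L = map enc M
          ; g-eval = reduce-eval x
          ; y-halts = A-halts y∈A
          ; r-eval = r-eval
          ; L-halts = Allₚ.map⁺ (All.tabulate λ u∈M → A-halts (proj₂ (sub u∈M)))
          ; L-below = Allₚ.map⁺ (All.tabulate λ {u} u∈M →
              subst₂ _<_ (sym (rankCode-enc u)) (sym (rankCode-enc y)) (firstStrings-rank (rank y) (proj₁ (sub u∈M))))
          ; L-unique = Unique.map⁺ enc-injective M-unique
          ; L-length = trans (length-map enc M) (trans (sym rank-s) (sym (rankCode-enc s)))
          ; z-below = subst₂ _<_ (sym (rankCode-enc (reduce x))) (sym (rankCode-enc y)) (rank-mono (reduce x) y gx<y)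
          ; z∉L = λ z∈ → let (u , u∈M , e) = ∈-map⁻ enc z∈ in x∉K (A⇒K (subst A (sym (enc-injective e)) (proj₂ (sub u∈M))))
          })

    rankCheck : ℕ → ℕ → ℕ → ℕ → ℕ → ℕ → Bool
    rankCheck z y s L C m =
      valid C ∧ (member (judgement ⌜ g ⌝ (cons m 0) z) C ∧ (records C ⌜ a ⌝ y ∧ (member (judgement ⌜ r ⌝ (cons y 0) s) C ∧
      (allL (λ l → records C ⌜ a ⌝ l ∧ (rankCode l <ᵇ rankCode y)) L ∧
      (distinct L ∧ ((lengthCode L ≡ᵇ rankCode s) ∧ ((rankCode z <ᵇ rankCode y) ∧ not (member z L))))))))

    rankCheckP : PrimB 6 (λ xs → rankCheck (lookup xs (# 0)) (lookup xs (# 1)) (lookup xs (# 2)) (lookup xs (# 3)) (lookup xs (# 4)) (lookup xs (# 5)))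
    rankCheckP =
      andP (comp₁ validP (varP (# 4)))
      (andP (comp₂ memberP (comp₃ judgementP (constP ⌜ g ⌝) (comp₂ consP (varP (# 5)) zeroP) v0) (varP (# 4)))
      (andP (comp₃ recordsP (varP (# 4)) (constP ⌜ a ⌝) v1)
      (andP (comp₂ memberP (comp₃ judgementP (constP ⌜ r ⌝) (comp₂ consP v1 zeroP) v2) (varP (# 4)))
      (andP (allIn (varP (# 3)) (andP (comp₃ recordsP (varP (# 5)) (constP ⌜ a ⌝) v0) (comp₁ rankCodeP v0 <P comp₁ rankCodeP v2)))
      (andP (comp₁ distinctP (varP (# 3)))
      (andP (comp₁ lengthCodeP (varP (# 3)) ==P comp₁ rankCodeP v2)
      (andP (comp₁ rankCodeP v0 <P comp₁ rankCodeP v1)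
      (notP (comp₂ memberP v0 (varP (# 3)))))))))))

    witnessCheck : ℕ → ℕ → Bool
    witnessCheck w m = unpack₅ (λ z y s L C → rankCheck z y s L C m) w

    rankCheck-sound : ∀ z y s L C m → rankCheck z y s L C m ≡ true → Witness m
    rankCheck-sound z y s L C m h =
      let (C-valid , h) = ∧-true {valid C} h
          (g-in , h) = ∧-true {member (judgement ⌜ g ⌝ (cons m 0) z) C} h
          (y-in , h) = ∧-true {records C ⌜ a ⌝ y} h
          (r-in , h) = ∧-true {member (judgement ⌜ r ⌝ (cons y 0) s) C} h
          (L-in , h) = ∧-true {allL (λ l → records C ⌜ a ⌝ l ∧ (rankCode l <ᵇ rankCode y)) L} h
          (L-distinct , h) = ∧-true {distinct L} h
          (L-count , h) = ∧-true {lengthCode L ≡ᵇ rankCode s} h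
          (z-in , z-out) = ∧-true {rankCode z <ᵇ rankCode y} h
          Lˡ = toList L
          L-facts = allL-sound _ Lˡ (on-toList (allL (λ l → records C ⌜ a ⌝ l ∧ (rankCode l <ᵇ rankCode y))) L L-in)
      in record
        { z = z ; y = y ; s = s ; L = Lˡ
        ; g-eval = certificate-eval C C-valid g (m ∷ []) z g-in
        ; y-halts = records-sound C a y C-valid y-in
        ; r-eval = certificate-eval C C-valid r (y ∷ []) s r-in
        ; L-halts = All.map (λ {l} q → records-sound C a l C-valid (proj₁ (∧-true {records C ⌜ a ⌝ l} q))) L-facts
        ; L-below = All.map (λ {l} q → <ᵇ-true (proj₂ (∧-true {records C ⌜ a ⌝ l} q))) L-facts
        ; L-unique = distinct-sound Lˡ (on-toList distinct L L-distinct)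
        ; L-length = trans (sym (lengthCode-fromList Lˡ)) (trans (cong lengthCode (fromList-toList L)) (≡ᵇ-true L-count))
        ; z-below = <ᵇ-true z-in
        ; z∉L = λ z∈ → true≢false (trans (sym (member-complete z Lˡ z∈)) (trans (cong (member z) (fromList-toList L)) (not-true z-out)))
        }

    rankCheck-complete : ∀ {m} → Witness m → ∃ λ w → witnessCheck w m ≡ true
    rankCheck-complete {m} w =
      pack₅ z y s (fromList L) (fromList C) ,
      trans (unpack₅-pack₅ (λ z y s L C → rankCheck z y s L C m) z y s (fromList L) (fromList C))
        (∧-intro C-valid (∧-intro (member-complete _ C g-in) (∧-intro (records-complete C a y _ y-in)
        (∧-intro (member-complete _ C r-in) (∧-intro (allL-complete _ L L-facts) (∧-intro (distinct-complete L L-unique)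
        (∧-intro (≡ᵇ-intro (trans (lengthCode-fromList L) L-length)) (∧-intro (<ᵇ-intro z-below) (cong not (member-false z L z∉L))))))))))
      where
      open Witness w
      Cg = certificate-complete g-eval
      Ca = certificate-complete (proj₂ y-halts)
      Cr = certificate-complete r-eval
      CL = certify-all a L L-halts
      C : List ℕ
      C = proj₁ Cg ++ (proj₁ Ca ++ (proj₁ Cr ++ proj₁ CL))
      C-valid : valid (fromList C) ≡ true
      C-valid = valid-++ (proj₁ Cg) _ (proj₁ (proj₂ Cg)) (valid-++ (proj₁ Ca) _ (proj₁ (proj₂ Ca))
        (valid-++ (proj₁ Cr) _ (proj₁ (proj₂ Cr)) (proj₁ (proj₂ CL))))
      g-in = ∈-++⁺ˡ (proj₂ (proj₂ Cg))
      y-in = ∈-++⁺ʳ (proj₁ Cg) (∈-++⁺ˡ (proj₂ (proj₂ Ca)))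
      r-in = ∈-++⁺ʳ (proj₁ Cg) (∈-++⁺ʳ (proj₁ Ca) (∈-++⁺ˡ (proj₂ (proj₂ Cr))))
      L-facts : All (λ l → (records (fromList C) ⌜ a ⌝ l ∧ (rankCode l <ᵇ rankCode y)) ≡ true) L
      L-facts = All.zipWith (λ { {l} ((v , j) , lt) → ∧-intro
          (records-complete C a l v (∈-++⁺ʳ (proj₁ Cg) (∈-++⁺ʳ (proj₁ Ca) (∈-++⁺ʳ (proj₁ Cr) j)))) (<ᵇ-intro lt) })
        (proj₂ (proj₂ CL) , L-below)

    unbounded-impossible : (∀ z → ¬ ¬ (∃ λ y → A y × z <ₗₗ y)) → ⊥
    unbounded-impossible unbounded =
      co-K-not-semidecidable (search checkP) (search-semidecides checkP (λ x → ¬ K x) sound complete)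
      where
      checkP : PrimB 2 (λ xs → witnessCheck (at0 xs) (at1 xs))
      checkP = unpack₅P rankCheckP
      sound : ∀ x w → witnessCheck w (enc x) ≡ true → ¬ K x
      sound x w = Witness-sound x ∘ rankCheck-sound (π₁ w) (π₁ (π₂ w)) (π₁ (π₂ (π₂ w))) (π₁ (π₂ (π₂ (π₂ w)))) (π₂ (π₂ (π₂ (π₂ w)))) (enc x)
      complete : ∀ x → ¬ K x → ¬ ¬ ∃ λ w → witnessCheck w (enc x) ≡ true
      complete x x∉K k = unbounded (reduce x) λ (y , y∈A , gx<y) →
        Witness-complete x x∉K y y∈A gx<y λ w → k (rankCheck-complete w)

    impossible : ⊥
    impossible = ¬¬-excluded-middle {A = ∀ z → ¬ ¬ (∃ λ y → A y × z <ₗₗ y)} λ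
      { (yes unbounded) → unbounded-impossible unbounded
      ; (no ¬unbounded) → ¬unbounded λ z ¬above → bounded-impossible z λ y y∈A z<y → ¬above (y , y∈A , z<y) }

corollary10 : (A : Str → Set) → RE-complete A → ¬ FPR-rankable A
corollary10 A ((a , A-RE) , A-complete) (F , (r , r-computes-F) , F-ranks) =
  let (g , K≤A) = A-complete K (haltingCode , λ x → mk⇔ (λ k → k) (λ k → k))
  in Reduction.Ranked.impossible A a A-RE g K≤A r r-ranks
  where
  r-ranks : ∀ y i → IsIth A i y → ∃ λ s → Eval r (enc y ∷ []) (enc s) × rank s ≡ i
  r-ranks y i y-ith =
    let (s , Fys , s-ith) = F-ranks y i y-ith
    in s , Equivalence.to (r-computes-F y s) Fys , sym (ithString-rank i s s-ith)
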